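{- For any $0<\varepsilon<1$ there exists an integer $T\geq1$ such that for any $m,n$ and any matrix $A\in\mathbb F_q^{m\times n}$ the following holds. Choose $\boldsymbol\theta\in[T]$ uniformly at random and independent, identically distributed uniform indices $\mathbf i_1,\mathbf i_2,\ldots\in[n]$, also independent of $\boldsymbol\theta$. Let $\mathbf I$ be the $(\boldsymbol\theta-1)\times n$ matrix with entries $\mathbf I_{st}=\mathbf 1\{\mathbf i_s=t\}$ and let $A[\mathbf i_1,\ldots,\mathbf i_{\boldsymbol\theta-1}]$ be the matrix obtained by appending the rows of $\mathbf I$ below $A$. Then $$\Pr\big[\mu_{A[\mathbf i_1,\ldots,\mathbf i_{\boldsymbol\theta-1}]}\text{ is }(\varepsilon,2)\text{ -symmetric}\big]>1-\varepsilon.$$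
   Context: For a matrix $B\in\mathbb F_q^{m'\times n}$, $\mu_B$ is the uniform distribution on $\ker(B)\subseteq\mathbb F_q^n$. For a distribution $\mu$ on $\mathbb F_q^n$ and indices $i,j$, $\mu_i$ and $\mu_{i,j}$ denote the marginal distributions of coordinate $i$ and of the pair of coordinates $(i,j)$. $\mu$ is $(\varepsilon,2)$-symmetric if $\sum_{1\leq i_1<i_2\leq n}\|\mu_{i_1,i_2}-\mu_{i_1}\otimes\mu_{i_2}\|_{TV}<\varepsilon n^2$. $[T]=\{1,\dots,T\}$.
   Formalization: The parameter ε ranges over the rationals strictly between 0 and 1. -}

module Defs where

open import Level using (0ℓ)
open import Data.Nat as ℕ using (ℕ; zero; suc; _^_)
open import Data.Fin as Fin using (Fin; toℕ)
open import Data.Fin.Properties using () renaming (_≟_ to _≟ᶠ_)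
open import Data.Integer using (+_)
open import Data.Rational as ℚ using (ℚ; 0ℚ; ½)
open import Data.List as List using (List; []; _∷_; concatMap; map; filterᵇ; length; foldr; allFin)
open import Data.Bool using (Bool; true; false; if_then_else_; _∧_)
open import Data.Product using (_×_; _,_; Σ; ∃)
open import Data.Vec.Functional as VF using (Vector)
open import Function.Bundles using (_↔_; Inverse)
open import Relation.Nullary using (¬_)
open import Relation.Nullary.Decidable using (⌊_⌋)
open import Relation.Binary.Definitions using (DecidableEquality)
open import Relation.Binary.PropositionalEquality using (_≡_)
open import Algebra.Structures using (IsCommutativeRing)

record FiniteField : Set₁ where
  field
    F     : Set
    q     : ℕ
    enum  : Fin q ↔ F
    _≟_   : DecidableEquality F
    _+_   : F → F → F
    _*_   : F → F → F
    -_    : F → F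
    0#    : F
    1#    : F
    isCommutativeRing : IsCommutativeRing _≡_ _+_ _*_ -_ 0# 1#
    0≢1   : ¬ (0# ≡ 1#)
    inv   : ∀ x → ¬ (x ≡ 0#) → ∃ λ y → x * y ≡ 1#

allFuns : {X : Set} → (k : ℕ) → List X → List (Fin k → X)
allFuns zero    xs = (λ ()) ∷ []
allFuns (suc k) xs = concatMap (λ a → map (λ v → a VF.∷ v) (allFuns k xs)) xs

allᵇ : {X : Set} → (X → Bool) → List X → Bool
allᵇ p = foldr (λ x b → p x ∧ b) true

sumℚ : List ℚ → ℚ
sumℚ = foldr ℚ._+_ 0ℚ

-- a / b as a rational; (the b = 0 case never arises below since
-- kernels are nonempty and n ≥ 1)
ratio : ℕ → ℕ → ℚ
ratio a zero    = 0ℚ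
ratio a (suc b) = (+ a) ℚ./ suc b

module _ (𝔽 : FiniteField) where
  open FiniteField 𝔽

  elems : List F
  elems = map (Inverse.to enum) (allFin q)

  Vecs : (n : ℕ) → List (Fin n → F)
  Vecs n = allFuns n elems

  Matrix : ℕ → ℕ → Set
  Matrix m n = Fin m → Fin n → F

  sumF : ∀ n → (Fin n → F) → F
  sumF zero    f = 0#
  sumF (suc n) f = f Fin.zero + sumF n (λ i → f (Fin.suc i))

  inKer : ∀ {m n} → Matrix m n → (Fin n → F) → Bool
  inKer {m} {n} B x = allᵇ (λ r → ⌊ sumF n (λ t → B r t * x t) ≟ 0# ⌋) (allFin m)

  kernel : ∀ {m n} → Matrix m n → List (Fin n → F)
  kernel {n = n} B = filterᵇ (inKer B) (Vecs n)

  Dist : ℕ → Set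
  Dist n = (Fin n → F) → ℚ

  μ : ∀ {m n} → Matrix m n → Dist n
  μ B x = if inKer B x then ratio 1 (length (kernel B)) else 0ℚ

  marg₁ : ∀ {n} → Dist n → Fin n → F → ℚ
  marg₁ {n} d i a = sumℚ (map d (filterᵇ (λ x → ⌊ x i ≟ a ⌋) (Vecs n)))

  marg₂ : ∀ {n} → Dist n → Fin n → Fin n → F → F → ℚ
  marg₂ {n} d i j a b =
    sumℚ (map d (filterᵇ (λ x → ⌊ x i ≟ a ⌋ ∧ ⌊ x j ≟ b ⌋) (Vecs n)))

  tvPair : ∀ {n} → Dist n → Fin n → Fin n → ℚ
  tvPair d i j = ½ ℚ.* sumℚ (concatMap (λ a → map (λ b →
      ℚ.∣ marg₂ d i j a b ℚ.- marg₁ d i a ℚ.* marg₁ d j b ∣) elems) elems)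

  pairs : ∀ n → List (Fin n × Fin n)
  pairs n = concatMap (λ i → map (λ j → (i , j))
              (filterᵇ (λ j → ⌊ toℕ i ℕ.<? toℕ j ⌋) (allFin n))) (allFin n)

  symmetric2? : ∀ {n} → ℚ → Dist n → Bool
  symmetric2? {n} ε d =
    ⌊ sumℚ (map (λ { (i , j) → tvPair d i j }) (pairs n)) ℚ.<? ε ℚ.* ((+ (n ℕ.* n)) ℚ./ 1) ⌋

  indicator : ∀ {k n} → (Fin k → Fin n) → Matrix k n
  indicator is s t = if ⌊ is s ≟ᶠ t ⌋ then 1# else 0#

  append : ∀ {m n k} → Matrix m n → (Fin k → Fin n) → Matrix (m ℕ.+ k) n
  append A is = A VF.++ indicator is

  -- Pr over θ uniform in [T] and i.i.d. uniform i₁,i₂,… ∈ [n]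
  -- (only i₁,…,i_{θ-1} matter) that μ_{A[i₁,…,i_{θ-1}]} is (ε,2)-symmetric.
  -- Here s = θ - 1 ranges over 0,…,T-1.
  probSym : ∀ {m n} → ℕ → ℚ → Matrix m n → ℚ
  probSym {m} {n} T ε A =
    sumℚ (map (λ s → ratio 1 T ℚ.* ratio
        (length (filterᵇ (λ is → symmetric2? ε (μ (append A is)))
                         (allFuns (toℕ s) (allFin n))))
        (n ^ toℕ s))
      (allFin T))

module Submission where

open import Defs
open import Data.Nat using (ℕ; _≤_)
open import Data.Rational using (ℚ; 0ℚ; 1ℚ; _<_; _-_)
open import Data.Product using (Σ; _×_)

open import Data.Nat as ℕ using (zero; suc; _+_; _*_; _^_; _∸_; z≤n; s≤s; NonZero)
import Data.Nat.Properties as ℕₚ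
open import Data.Integer as ℤ using (+≤+; +<+; -[1+_])
import Data.Integer.Properties as ℤₚ
open import Data.Rational as ℚ using (mkℚ; ½; toℚᵘ)
import Data.Rational.Properties as ℚₚ
open import Data.Rational.Unnormalised as ℚᵘ using (mkℚᵘ; *≡*; *≤*; *<*)
import Data.Rational.Unnormalised.Properties as ℚᵘₚ
open import Data.Bool using (Bool; true; false; if_then_else_; _∧_; not)
import Data.Bool.Properties as Boolₚ
open import Data.List using (List; []; _∷_; map; concatMap; filterᵇ; length; tabulate; allFin; _++_)
import Data.List.Properties as Listₚ
open import Data.Fin as Fin using (Fin; toℕ; _↑ˡ_; _↑ʳ_)
open import Data.Fin.Properties using (splitAt-↑ˡ; splitAt-↑ʳ; suc-injective) renaming (_≟_ to _≟ᶠ_)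
open import Data.Vec.Functional as VF using (Vector)
open import Data.Product using (∃; _,_; proj₁; proj₂)
open import Data.Empty using (⊥-elim)
open import Function using (_∘_; id)
open import Function.Bundles using (Inverse)
open import Relation.Nullary using (¬_; Dec; yes; no)
open import Relation.Nullary.Decidable using (⌊_⌋)
open import Relation.Binary.PropositionalEquality
open import Algebra.Bundles using (CommutativeMonoid; CommutativeRing)
open import Level using (0ℓ)
open import Data.Nat.Tactic.RingSolver using (solve-∀)
open import Algebra.Properties.CommutativeSemigroup ℕₚ.+-commutativeSemigroup
  using () renaming (interchange to +-interchange)
open import Algebra.Properties.CommutativeSemigroup (CommutativeMonoid.commutativeSemigroup ℚₚ.+-0-commutativeMonoid)
  using () renaming (interchange to +ℚ-interchange)

-- A coordinate is frozen if it vanishes on the whole kernel, and two free coordinates i, j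
-- are linked if x i = 0 forces x j = 0 on the kernel. For an unlinked pair, either one
-- coordinate is frozen or (x i , x j) is uniform on F × F (translate by a kernel vector), so
-- the pair marginal is a product; hence the total pairwise TV distance of μ_B is at most q²
-- times the number of linked pairs, and an asymmetric μ_B has at least ε n² / q² of them.
-- Pinning a uniformly random coordinate i freezes every j linked to i, so one pinning step
-- raises the expected number of frozen coordinates by at least 1 / n times the expected
-- number of linked pairs. As at most n coordinates can be frozen, summing over the steps
-- bounds the expected number of asymmetric steps by q² / ε ≤ r q² (for ε = p / r),
-- uniformly in m, n and A; a horizon T much larger than this makes them negligible.

-- Finite sums and fractions

⟦_⟧ : Bool → ℕ
⟦ true ⟧  = 1
⟦ false ⟧ = 0

⟦∧⟧ : ∀ b c → ⟦ b ∧ c ⟧ ≡ ⟦ b ⟧ * ⟦ c ⟧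
⟦∧⟧ true  c = sym (ℕₚ.+-identityʳ ⟦ c ⟧)
⟦∧⟧ false c = refl

⟦⟧≤1 : ∀ b → ⟦ b ⟧ ≤ 1
⟦⟧≤1 true  = s≤s z≤n
⟦⟧≤1 false = z≤n

⟦∧⟧≤ʳ : ∀ b c → ⟦ b ∧ c ⟧ ≤ ⟦ c ⟧
⟦∧⟧≤ʳ true  c = ℕₚ.≤-refl
⟦∧⟧≤ʳ false c = z≤n

⟦⟧≢0⇒true : ∀ {b} → ¬ ⟦ b ⟧ ≡ 0 → b ≡ true
⟦⟧≢0⇒true {true}  _ = refl
⟦⟧≢0⇒true {false} h = ⊥-elim (h refl)

∑ : {X : Set} → List X → (X → ℕ) → ℕ
∑ []      f = 0
∑ (x ∷ L) f = f x + ∑ L f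

syntax ∑ L (λ x → e) = ∑[ x ∈ L ] e

module _ {X : Set} where

  ∑-cong : (L : List X) {f g : X → ℕ} → (∀ x → f x ≡ g x) → ∑ L f ≡ ∑ L g
  ∑-cong []      e = refl
  ∑-cong (x ∷ L) e = cong₂ _+_ (e x) (∑-cong L e)

  ∑-mono-≤ : (L : List X) {f g : X → ℕ} → (∀ x → f x ≤ g x) → ∑ L f ≤ ∑ L g
  ∑-mono-≤ []      e = z≤n
  ∑-mono-≤ (x ∷ L) e = ℕₚ.+-mono-≤ (e x) (∑-mono-≤ L e)

  ∑-zero : (L : List X) → ∑[ x ∈ L ] 0 ≡ 0
  ∑-zero []      = refl
  ∑-zero (x ∷ L) = ∑-zero L

  ∑-const : (L : List X) (c : ℕ) → ∑[ x ∈ L ] c ≡ length L * c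
  ∑-const []      c = refl
  ∑-const (x ∷ L) c = cong (c +_) (∑-const L c)

  ∑-distrib-+ : (L : List X) (f g : X → ℕ) → ∑[ x ∈ L ] (f x + g x) ≡ ∑ L f + ∑ L g
  ∑-distrib-+ []      f g = refl
  ∑-distrib-+ (x ∷ L) f g =
    trans (cong (f x + g x +_) (∑-distrib-+ L f g)) (+-interchange (f x) (g x) (∑ L f) (∑ L g))

  ∑-distribˡ-* : (L : List X) (c : ℕ) (f : X → ℕ) → ∑[ x ∈ L ] (c * f x) ≡ c * ∑ L f
  ∑-distribˡ-* []      c f = sym (ℕₚ.*-zeroʳ c)
  ∑-distribˡ-* (x ∷ L) c f =
    trans (cong (c * f x +_) (∑-distribˡ-* L c f)) (sym (ℕₚ.*-distribˡ-+ c (f x) (∑ L f)))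

  ∑-distribʳ-* : (L : List X) (c : ℕ) (f : X → ℕ) → ∑[ x ∈ L ] (f x * c) ≡ ∑ L f * c
  ∑-distribʳ-* L c f = begin
    ∑[ x ∈ L ] (f x * c) ≡⟨ ∑-cong L (λ x → ℕₚ.*-comm (f x) c) ⟩
    ∑[ x ∈ L ] (c * f x) ≡⟨ ∑-distribˡ-* L c f ⟩
    c * ∑ L f            ≡⟨ ℕₚ.*-comm c (∑ L f) ⟩
    ∑ L f * c            ∎
    where open ≡-Reasoning

  ∑≢0⇒∃≢0 : (L : List X) (f : X → ℕ) → ¬ ∑ L f ≡ 0 → ∃ λ x → ¬ f x ≡ 0
  ∑≢0⇒∃≢0 []      f h = ⊥-elim (h refl)
  ∑≢0⇒∃≢0 (x ∷ L) f h with f x in eq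
  ... | zero  = ∑≢0⇒∃≢0 L f h
  ... | suc k = x , λ fx≡0 → ℕₚ.1+n≢0 (trans (sym eq) fx≡0)

  ∑-++ : (L M : List X) (f : X → ℕ) → ∑ (L ++ M) f ≡ ∑ L f + ∑ M f
  ∑-++ []      M f = refl
  ∑-++ (x ∷ L) M f = trans (cong (f x +_) (∑-++ L M f)) (sym (ℕₚ.+-assoc (f x) (∑ L f) (∑ M f)))

  ∑-filterᵇ : (L : List X) (p : X → Bool) (f : X → ℕ) →
    ∑ (filterᵇ p L) f ≡ ∑[ x ∈ L ] (⟦ p x ⟧ * f x)
  ∑-filterᵇ []      p f = refl
  ∑-filterᵇ (x ∷ L) p f with p x
  ... | true  = cong₂ _+_ (sym (ℕₚ.+-identityʳ (f x))) (∑-filterᵇ L p f)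
  ... | false = ∑-filterᵇ L p f

  length-filterᵇ : (L : List X) (p : X → Bool) → length (filterᵇ p L) ≡ ∑[ x ∈ L ] ⟦ p x ⟧
  length-filterᵇ []      p = refl
  length-filterᵇ (x ∷ L) p with p x
  ... | true  = cong suc (length-filterᵇ L p)
  ... | false = length-filterᵇ L p

∑-map : {X Y : Set} (L : List X) (f : X → Y) (g : Y → ℕ) → ∑ (map f L) g ≡ ∑ L (g ∘ f)
∑-map []      f g = refl
∑-map (x ∷ L) f g = cong (g (f x) +_) (∑-map L f g)

∑-concatMap : {X Y : Set} (L : List X) (f : X → List Y) (g : Y → ℕ) →
  ∑ (concatMap f L) g ≡ ∑[ x ∈ L ] ∑ (f x) g
∑-concatMap []      f g = refl
∑-concatMap (x ∷ L) f g =
  trans (∑-++ (f x) (concatMap f L) g) (cong (∑ (f x) g +_) (∑-concatMap L f g))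

∑-comm : {X Y : Set} (L : List X) (M : List Y) (h : X → Y → ℕ) →
  ∑[ x ∈ L ] ∑[ y ∈ M ] h x y ≡ ∑[ y ∈ M ] ∑[ x ∈ L ] h x y
∑-comm []      M h = sym (∑-zero M)
∑-comm (x ∷ L) M h =
  trans (cong (∑ M (h x) +_) (∑-comm L M h)) (sym (∑-distrib-+ M (h x) (λ y → ∑[ x ∈ L ] h x y)))

∑-tabulate : {Y : Set} (n : ℕ) (f : Fin n → Y) (g : Y → ℕ) → ∑ (tabulate f) g ≡ ∑ (allFin n) (g ∘ f)
∑-tabulate zero    f g = refl
∑-tabulate (suc n) f g = cong (g (f Fin.zero) +_)
  (trans (∑-tabulate n (f ∘ Fin.suc) g) (sym (∑-tabulate n Fin.suc (g ∘ f))))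

∑-allFin-suc : (n : ℕ) (g : Fin (suc n) → ℕ) →
  ∑ (allFin (suc n)) g ≡ g Fin.zero + ∑ (allFin n) (g ∘ Fin.suc)
∑-allFin-suc n g = cong (g Fin.zero +_) (∑-tabulate n Fin.suc g)

length-allFin : ∀ n → length (allFin n) ≡ n
length-allFin n = Listₚ.length-tabulate id

private
  toℚᵘ-ratio : ∀ a b → toℚᵘ (ratio a (suc b)) ℚᵘ.≃ mkℚᵘ (ℤ.+ a) b
  toℚᵘ-ratio a b = ℚₚ.toℚᵘ-fromℚᵘ (mkℚᵘ (ℤ.+ a) b)

ratio-cong : ∀ a b c d .{{_ : NonZero b}} .{{_ : NonZero d}} → a * d ≡ c * b → ratio a b ≡ ratio c d
ratio-cong a (suc b) c (suc d) h = ℚₚ.toℚᵘ-injective (begin-equality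
  toℚᵘ (ratio a (suc b)) ≃⟨ toℚᵘ-ratio a b ⟩
  mkℚᵘ (ℤ.+ a) b         ≃⟨ *≡* (trans (sym (ℤₚ.pos-* a (suc d))) (trans (cong ℤ.+_ h) (ℤₚ.pos-* c (suc b)))) ⟩
  mkℚᵘ (ℤ.+ c) d         ≃⟨ toℚᵘ-ratio c d ⟨
  toℚᵘ (ratio c (suc d)) ∎)
  where open ℚᵘₚ.≤-Reasoning

ratio-mono-≤ : ∀ a b c d .{{_ : NonZero b}} .{{_ : NonZero d}} → a * d ≤ c * b → ratio a b ℚ.≤ ratio c d
ratio-mono-≤ a (suc b) c (suc d) h = ℚₚ.toℚᵘ-cancel-≤ (begin
  toℚᵘ (ratio a (suc b)) ≃⟨ toℚᵘ-ratio a b ⟩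
  mkℚᵘ (ℤ.+ a) b         ≤⟨ *≤* (subst₂ ℤ._≤_ (ℤₚ.pos-* a (suc d)) (ℤₚ.pos-* c (suc b)) (+≤+ h)) ⟩
  mkℚᵘ (ℤ.+ c) d         ≃⟨ toℚᵘ-ratio c d ⟨
  toℚᵘ (ratio c (suc d)) ∎)
  where open ℚᵘₚ.≤-Reasoning

ratio-mono-< : ∀ a b c d .{{_ : NonZero b}} .{{_ : NonZero d}} → a * d ℕ.< c * b → ratio a b ℚ.< ratio c d
ratio-mono-< a (suc b) c (suc d) h = ℚₚ.toℚᵘ-cancel-< (begin-strict
  toℚᵘ (ratio a (suc b)) ≃⟨ toℚᵘ-ratio a b ⟩
  mkℚᵘ (ℤ.+ a) b         <⟨ *<* (subst₂ ℤ._<_ (ℤₚ.pos-* a (suc d)) (ℤₚ.pos-* c (suc b)) (+<+ h)) ⟩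
  mkℚᵘ (ℤ.+ c) d         ≃⟨ toℚᵘ-ratio c d ⟨
  toℚᵘ (ratio c (suc d)) ∎)
  where open ℚᵘₚ.≤-Reasoning

ratio-cancel-≤ : ∀ a b c d .{{_ : NonZero b}} .{{_ : NonZero d}} → ratio a b ℚ.≤ ratio c d → a * d ≤ c * b
ratio-cancel-≤ a (suc b) c (suc d) h
  with ℚᵘₚ.≤-respʳ-≃ (toℚᵘ-ratio c d) (ℚᵘₚ.≤-respˡ-≃ (toℚᵘ-ratio a b) (ℚₚ.toℚᵘ-mono-≤ h))
... | *≤* le = ℤₚ.drop‿+≤+ (subst₂ ℤ._≤_ (sym (ℤₚ.pos-* a (suc d))) (sym (ℤₚ.pos-* c (suc b))) le)

ratio-+ : ∀ a b c d .{{_ : NonZero b}} .{{_ : NonZero d}} →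
  ratio a b ℚ.+ ratio c d ≡ ratio (a * d + c * b) (b * d)
ratio-+ a (suc b) c (suc d) = ℚₚ.toℚᵘ-injective (begin-equality
  toℚᵘ (ratio a (suc b) ℚ.+ ratio c (suc d))
    ≃⟨ ℚₚ.toℚᵘ-homo-+ (ratio a (suc b)) (ratio c (suc d)) ⟩
  toℚᵘ (ratio a (suc b)) ℚᵘ.+ toℚᵘ (ratio c (suc d))
    ≃⟨ ℚᵘₚ.+-cong (toℚᵘ-ratio a b) (toℚᵘ-ratio c d) ⟩
  mkℚᵘ (ℤ.+ a) b ℚᵘ.+ mkℚᵘ (ℤ.+ c) d
    ≡⟨ cong (λ z → mkℚᵘ z (ℕ.pred (suc b * suc d)))
         (trans (cong₂ ℤ._+_ (sym (ℤₚ.pos-* a (suc d))) (sym (ℤₚ.pos-* c (suc b))))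
                (sym (ℤₚ.pos-+ (a * suc d) (c * suc b)))) ⟩
  mkℚᵘ (ℤ.+ (a * suc d + c * suc b)) (ℕ.pred (suc b * suc d))
    ≃⟨ toℚᵘ-ratio _ _ ⟨
  toℚᵘ (ratio (a * suc d + c * suc b) (suc b * suc d)) ∎)
  where open ℚᵘₚ.≤-Reasoning

ratio-* : ∀ a b c d .{{_ : NonZero b}} .{{_ : NonZero d}} →
  ratio a b ℚ.* ratio c d ≡ ratio (a * c) (b * d)
ratio-* a (suc b) c (suc d) = ℚₚ.toℚᵘ-injective (begin-equality
  toℚᵘ (ratio a (suc b) ℚ.* ratio c (suc d))
    ≃⟨ ℚₚ.toℚᵘ-homo-* (ratio a (suc b)) (ratio c (suc d)) ⟩
  toℚᵘ (ratio a (suc b)) ℚᵘ.* toℚᵘ (ratio c (suc d))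
    ≃⟨ ℚᵘₚ.*-cong (toℚᵘ-ratio a b) (toℚᵘ-ratio c d) ⟩
  mkℚᵘ (ℤ.+ a) b ℚᵘ.* mkℚᵘ (ℤ.+ c) d
    ≡⟨ cong (λ z → mkℚᵘ z (ℕ.pred (suc b * suc d))) (sym (ℤₚ.pos-* a c)) ⟩
  mkℚᵘ (ℤ.+ (a * c)) (ℕ.pred (suc b * suc d))
    ≃⟨ toℚᵘ-ratio _ _ ⟨
  toℚᵘ (ratio (a * c) (suc b * suc d)) ∎)
  where open ℚᵘₚ.≤-Reasoning

ratio-+-sameDenom : ∀ a b c .{{_ : NonZero b}} → ratio a b ℚ.+ ratio c b ≡ ratio (a + c) b
ratio-+-sameDenom a b c = trans (ratio-+ a b c b) (ratio-cong _ _ (a + c) b {{ℕₚ.m*n≢0 b b}} (begin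
  (a * b + c * b) * b ≡⟨ cong (_* b) (ℕₚ.*-distribʳ-+ b a c) ⟨
  (a + c) * b * b     ≡⟨ ℕₚ.*-assoc (a + c) b b ⟩
  (a + c) * (b * b)   ∎))
  where open ≡-Reasoning

ratio-zero : ∀ b → ratio 0 b ≡ 0ℚ
ratio-zero zero    = refl
ratio-zero (suc b) = ratio-cong 0 (suc b) 0 1 refl

ratio-nonNeg : ∀ a b → 0ℚ ℚ.≤ ratio a b
ratio-nonNeg a zero    = ℚₚ.≤-refl
ratio-nonNeg a (suc b) = subst (ℚ._≤ ratio a (suc b)) (ratio-zero 1) (ratio-mono-≤ 0 1 a (suc b) z≤n)

ratio-mono-≤-numerator : ∀ a c b .{{_ : NonZero b}} → a ≤ c → ratio a b ℚ.≤ ratio c b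
ratio-mono-≤-numerator a c b a≤c = ratio-mono-≤ a b c b (ℕₚ.*-monoˡ-≤ b a≤c)

ratio-scale : ∀ k a b .{{_ : NonZero k}} .{{_ : NonZero b}} → ratio a b ≡ ratio (k * a) (k * b)
ratio-scale k a b {{_}} {{b≢0}} = ratio-cong a b (k * a) (k * b) {{b≢0}} {{ℕₚ.m*n≢0 k b}} (begin
  a * (k * b) ≡⟨ ℕₚ.*-assoc a k b ⟨
  a * k * b   ≡⟨ cong (_* b) (ℕₚ.*-comm a k) ⟩
  k * a * b   ∎)
  where open ≡-Reasoning

ratio≤1 : ∀ c K .{{_ : NonZero K}} → c ≤ K → ratio c K ℚ.≤ 1ℚ
ratio≤1 c K c≤K = ratio-mono-≤ c K 1 1 (ℕₚ.≤-trans (ℕₚ.≤-reflexive (ℕₚ.*-identityʳ c))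
                                       (ℕₚ.≤-trans c≤K (ℕₚ.≤-reflexive (sym (ℕₚ.*-identityˡ K)))))

ratio-self : ∀ K .{{_ : NonZero K}} → ratio K K ≡ 1ℚ
ratio-self K = ratio-cong K K 1 1 (trans (ℕₚ.*-identityʳ K) (sym (ℕₚ.*-identityˡ K)))

p+q-q≡p : ∀ x b → x ℚ.+ b ℚ.- b ≡ x
p+q-q≡p x b = trans (ℚₚ.+-assoc x b (ℚ.- b)) (trans (cong (x ℚ.+_) (ℚₚ.+-inverseʳ b)) (ℚₚ.+-identityʳ x))

1-ratio : ∀ p r .{{_ : NonZero r}} → p ≤ r → 1ℚ ℚ.- ratio p r ≡ ratio (r ∸ p) r
1-ratio p r p≤r = begin
  1ℚ ℚ.- ratio p r                           ≡⟨ cong (ℚ._- ratio p r) (ratio-self r) ⟨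
  ratio r r ℚ.- ratio p r                    ≡⟨ cong (λ c → ratio c r ℚ.- ratio p r) (ℕₚ.m∸n+n≡m p≤r) ⟨
  ratio (r ∸ p + p) r ℚ.- ratio p r          ≡⟨ cong (ℚ._- ratio p r) (ratio-+-sameDenom (r ∸ p) r p) ⟨
  ratio (r ∸ p) r ℚ.+ ratio p r ℚ.- ratio p r ≡⟨ p+q-q≡p (ratio (r ∸ p) r) (ratio p r) ⟩
  ratio (r ∸ p) r                            ∎
  where open ≡-Reasoning

∑ℚ : {X : Set} → List X → (X → ℚ) → ℚ
∑ℚ L f = sumℚ (map f L)

syntax ∑ℚ L (λ x → e) = ∑ℚ[ x ∈ L ] e

module _ {X : Set} where

  ∑ℚ-cong : (L : List X) {f g : X → ℚ} → (∀ x → f x ≡ g x) → ∑ℚ L f ≡ ∑ℚ L g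
  ∑ℚ-cong []      e = refl
  ∑ℚ-cong (x ∷ L) e = cong₂ ℚ._+_ (e x) (∑ℚ-cong L e)

  ∑ℚ-mono-≤ : (L : List X) {f g : X → ℚ} → (∀ x → f x ℚ.≤ g x) → ∑ℚ L f ℚ.≤ ∑ℚ L g
  ∑ℚ-mono-≤ []      e = ℚₚ.≤-refl
  ∑ℚ-mono-≤ (x ∷ L) e = ℚₚ.+-mono-≤ (e x) (∑ℚ-mono-≤ L e)

  ∑ℚ-zero : (L : List X) → ∑ℚ[ x ∈ L ] 0ℚ ≡ 0ℚ
  ∑ℚ-zero []      = refl
  ∑ℚ-zero (x ∷ L) = trans (ℚₚ.+-identityˡ _) (∑ℚ-zero L)

  ∑ℚ-nonNeg : (L : List X) (f : X → ℚ) → (∀ x → 0ℚ ℚ.≤ f x) → 0ℚ ℚ.≤ ∑ℚ L f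
  ∑ℚ-nonNeg L f h = subst (ℚ._≤ ∑ℚ L f) (∑ℚ-zero L) (∑ℚ-mono-≤ L h)

  ∑ℚ-distrib-+ : (L : List X) (f g : X → ℚ) → ∑ℚ[ x ∈ L ] (f x ℚ.+ g x) ≡ ∑ℚ L f ℚ.+ ∑ℚ L g
  ∑ℚ-distrib-+ []      f g = refl
  ∑ℚ-distrib-+ (x ∷ L) f g = trans (cong (f x ℚ.+ g x ℚ.+_) (∑ℚ-distrib-+ L f g))
    (+ℚ-interchange (f x) (g x) (∑ℚ L f) (∑ℚ L g))

  ∑ℚ-distribˡ-* : (L : List X) (c : ℚ) (f : X → ℚ) → ∑ℚ[ x ∈ L ] (c ℚ.* f x) ≡ c ℚ.* ∑ℚ L f
  ∑ℚ-distribˡ-* []      c f = sym (ℚₚ.*-zeroʳ c)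
  ∑ℚ-distribˡ-* (x ∷ L) c f = trans (cong (c ℚ.* f x ℚ.+_) (∑ℚ-distribˡ-* L c f))
    (sym (ℚₚ.*-distribˡ-+ c (f x) (∑ℚ L f)))

  ∑ℚ-ratio : (L : List X) (g : X → ℕ) → ∑ℚ[ x ∈ L ] ratio (g x) 1 ≡ ratio (∑ L g) 1
  ∑ℚ-ratio []      g = refl
  ∑ℚ-ratio (x ∷ L) g = trans (cong (ratio (g x) 1 ℚ.+_) (∑ℚ-ratio L g)) (ratio-+-sameDenom (g x) 1 (∑ L g))

sumℚ-++ : (L M : List ℚ) → sumℚ (L ++ M) ≡ sumℚ L ℚ.+ sumℚ M
sumℚ-++ []      M = sym (ℚₚ.+-identityˡ _)
sumℚ-++ (x ∷ L) M = trans (cong (x ℚ.+_) (sumℚ-++ L M)) (sym (ℚₚ.+-assoc x _ _))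

sumℚ-concatMap : {X : Set} (L : List X) (g : X → List ℚ) →
  sumℚ (concatMap g L) ≡ ∑ℚ[ x ∈ L ] sumℚ (g x)
sumℚ-concatMap []      g = refl
sumℚ-concatMap (x ∷ L) g =
  trans (sumℚ-++ (g x) (concatMap g L)) (cong (sumℚ (g x) ℚ.+_) (sumℚ-concatMap L g))

∑ℚ-tabulate : {Y : Set} (n : ℕ) (f : Fin n → Y) (g : Y → ℚ) → ∑ℚ (tabulate f) g ≡ ∑ℚ (allFin n) (g ∘ f)
∑ℚ-tabulate zero    f g = refl
∑ℚ-tabulate (suc n) f g = cong (g (f Fin.zero) ℚ.+_)
  (trans (∑ℚ-tabulate n (f ∘ Fin.suc) g) (sym (∑ℚ-tabulate n Fin.suc (g ∘ f))))

true-ext : ∀ {b c : Bool} → (b ≡ true → c ≡ true) → (c ≡ true → b ≡ true) → b ≡ c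
true-ext {true}  {true}  _ _ = refl
true-ext {true}  {false} f _ = sym (f refl)
true-ext {false} {true}  _ g = g refl
true-ext {false} {false} _ _ = refl

∧≡true⇒ : ∀ {b c} → b ∧ c ≡ true → b ≡ true × c ≡ true
∧≡true⇒ {true} {true} _ = refl , refl

module _ {A : Set} where

  ⌊⌋≡true⇒ : (d : Dec A) → ⌊ d ⌋ ≡ true → A
  ⌊⌋≡true⇒ (yes a) _ = a

  ⌊⌋≡false⇒ : (d : Dec A) → ⌊ d ⌋ ≡ false → ¬ A
  ⌊⌋≡false⇒ (no ¬a) _ = ¬a

  ⇒⌊⌋≡true : (d : Dec A) → A → ⌊ d ⌋ ≡ true
  ⇒⌊⌋≡true (yes _) _ = refl
  ⇒⌊⌋≡true (no ¬a) a = ⊥-elim (¬a a)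

  ⇒⌊⌋≡false : (d : Dec A) → ¬ A → ⌊ d ⌋ ≡ false
  ⇒⌊⌋≡false (yes a) ¬a = ⊥-elim (¬a a)
  ⇒⌊⌋≡false (no _)  _  = refl

⌊⌋-cong : {A B : Set} → (A → B) → (B → A) → (a? : Dec A) (b? : Dec B) → ⌊ a? ⌋ ≡ ⌊ b? ⌋
⌊⌋-cong f g a? b? = true-ext (λ h → ⇒⌊⌋≡true b? (f (⌊⌋≡true⇒ a? h)))
                             (λ h → ⇒⌊⌋≡true a? (g (⌊⌋≡true⇒ b? h)))

∑-allFin-δ : ∀ {q} (k₀ : Fin q) → ∑[ k ∈ allFin q ] ⟦ ⌊ k ≟ᶠ k₀ ⌋ ⟧ ≡ 1
∑-allFin-δ {suc q} Fin.zero = trans (∑-allFin-suc q (λ k → ⟦ ⌊ k ≟ᶠ Fin.zero ⌋ ⟧)) (cong suc (begin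
  ∑[ k ∈ allFin q ] ⟦ ⌊ Fin.suc k ≟ᶠ Fin.zero ⌋ ⟧ ≡⟨ ∑-cong (allFin q) (λ k → cong ⟦_⟧
                                                        (⇒⌊⌋≡false (Fin.suc k ≟ᶠ Fin.zero) λ ())) ⟩
  ∑[ k ∈ allFin q ] 0                             ≡⟨ ∑-zero (allFin q) ⟩
  0                                               ∎))
  where open ≡-Reasoning
∑-allFin-δ {suc q} (Fin.suc k₀) = trans (∑-allFin-suc q (λ k → ⟦ ⌊ k ≟ᶠ Fin.suc k₀ ⌋ ⟧)) (begin
  ∑[ k ∈ allFin q ] ⟦ ⌊ Fin.suc k ≟ᶠ Fin.suc k₀ ⌋ ⟧ ≡⟨ ∑-cong (allFin q) (λ k → cong ⟦_⟧
                                     (⌊⌋-cong suc-injective (cong Fin.suc) _ (k ≟ᶠ k₀))) ⟩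
  ∑[ k ∈ allFin q ] ⟦ ⌊ k ≟ᶠ k₀ ⌋ ⟧                 ≡⟨ ∑-allFin-δ k₀ ⟩
  1                                                 ∎)
  where open ≡-Reasoning

-- Counting vectors over a finite field

module Field (𝔽 : FiniteField) where

  open FiniteField 𝔽 public renaming (_+_ to infixl 6 _+ᶠ_; _*_ to infixl 7 _*ᶠ_; -_ to infix 8 -ᶠ_)

  commutativeRing : CommutativeRing 0ℓ 0ℓ
  commutativeRing = record { isCommutativeRing = isCommutativeRing }

  open CommutativeRing commutativeRing public
    using (+-assoc; +-comm; +-identityˡ; +-identityʳ; *-assoc; *-comm; *-identityˡ; *-identityʳ;
           distribˡ; zeroˡ; zeroʳ; -‿inverseʳ; +-group; ring)
  open import Algebra.Properties.Group +-group public
    using (//-rightDividesˡ; //-rightDividesʳ)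
  open import Algebra.Properties.Ring ring public using (-1*x≈-x)

  infix 4 _==_ _==ᵥ_
  infixl 6 _+ᵥ_
  infixl 7 _·ᵥ_

  _==_ : F → F → Bool
  a == b = ⌊ a ≟ b ⌋

  ==-sym : ∀ a b → (a == b) ≡ (b == a)
  ==-sym a b = ⌊⌋-cong sym sym (a ≟ b) (b ≟ a)

  ∑-elems-δ : ∀ e → ∑[ a ∈ elems 𝔽 ] ⟦ a == e ⟧ ≡ 1
  ∑-elems-δ e = begin
    ∑[ a ∈ elems 𝔽 ] ⟦ a == e ⟧              ≡⟨ ∑-map (allFin q) to _ ⟩
    ∑[ k ∈ allFin q ] ⟦ to k == e ⟧          ≡⟨ ∑-cong (allFin q) (λ k → cong ⟦_⟧
       (⌊⌋-cong (λ p → trans (sym (Inverse.inverseʳ enum refl)) (cong from p))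
                (λ p → trans (cong to p) (Inverse.inverseˡ enum refl)) (to k ≟ e) (k ≟ᶠ from e))) ⟩
    ∑[ k ∈ allFin q ] ⟦ ⌊ k ≟ᶠ from e ⌋ ⟧   ≡⟨ ∑-allFin-δ (from e) ⟩
    1                                        ∎
    where
    open ≡-Reasoning
    to = Inverse.to enum
    from = Inverse.from enum

  length-elems : length (elems 𝔽) ≡ q
  length-elems = trans (Listₚ.length-map (Inverse.to enum) (allFin q)) (length-allFin q)

  _+ᵥ_ : ∀ {n} → Vector F n → Vector F n → Vector F n
  (x +ᵥ y) t = x t +ᶠ y t

  _·ᵥ_ : ∀ {n} → F → Vector F n → Vector F n
  (c ·ᵥ x) t = c *ᶠ x t

  0ᵥ : ∀ {n} → Vector F n
  0ᵥ t = 0#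

  Extensional : ∀ {n} {A : Set} → (Vector F n → A) → Set
  Extensional {n} p = ∀ x y → x ≗ y → p x ≡ p y

  _==ᵥ_ : ∀ {n} → Vector F n → Vector F n → Bool
  _==ᵥ_ {zero}  x y = true
  _==ᵥ_ {suc n} x y = (x Fin.zero == y Fin.zero) ∧ (x ∘ Fin.suc ==ᵥ y ∘ Fin.suc)

  ==ᵥ⇒≗ : ∀ {n} (x y : Vector F n) → (x ==ᵥ y) ≡ true → x ≗ y
  ==ᵥ⇒≗ {suc n} x y h Fin.zero    = ⌊⌋≡true⇒ (x Fin.zero ≟ y Fin.zero) (proj₁ (∧≡true⇒ h))
  ==ᵥ⇒≗ {suc n} x y h (Fin.suc t) =
    ==ᵥ⇒≗ (x ∘ Fin.suc) (y ∘ Fin.suc) (proj₂ (∧≡true⇒ {x Fin.zero == y Fin.zero} h)) t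

  ≗⇒==ᵥ : ∀ {n} (x y : Vector F n) → x ≗ y → (x ==ᵥ y) ≡ true
  ≗⇒==ᵥ {zero}  x y h = refl
  ≗⇒==ᵥ {suc n} x y h = cong₂ _∧_ (⇒⌊⌋≡true (x Fin.zero ≟ y Fin.zero) (h Fin.zero))
                                  (≗⇒==ᵥ (x ∘ Fin.suc) (y ∘ Fin.suc) (h ∘ Fin.suc))

  ∑-Vecs-suc : ∀ n (g : Vector F (suc n) → ℕ) →
    ∑ (Vecs 𝔽 (suc n)) g ≡ ∑[ a ∈ elems 𝔽 ] ∑[ v ∈ Vecs 𝔽 n ] g (a VF.∷ v)
  ∑-Vecs-suc n g = trans (∑-concatMap (elems 𝔽) _ g) (∑-cong (elems 𝔽) (λ a → ∑-map (Vecs 𝔽 n) _ g))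

  ∑-Vecs-δ : ∀ n (e : Vector F n) → ∑[ x ∈ Vecs 𝔽 n ] ⟦ x ==ᵥ e ⟧ ≡ 1
  ∑-Vecs-δ zero    e = refl
  ∑-Vecs-δ (suc n) e = begin
    ∑[ x ∈ Vecs 𝔽 (suc n) ] ⟦ x ==ᵥ e ⟧
      ≡⟨ ∑-Vecs-suc n _ ⟩
    ∑[ a ∈ elems 𝔽 ] ∑[ v ∈ Vecs 𝔽 n ] ⟦ (a == e Fin.zero) ∧ (v ==ᵥ e ∘ Fin.suc) ⟧
      ≡⟨ ∑-cong (elems 𝔽) (λ a → trans (∑-cong (Vecs 𝔽 n) (λ v → ⟦∧⟧ (a == e Fin.zero) _))
                                       (∑-distribˡ-* (Vecs 𝔽 n) ⟦ a == e Fin.zero ⟧ _)) ⟩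
    ∑[ a ∈ elems 𝔽 ] (⟦ a == e Fin.zero ⟧ * ∑[ v ∈ Vecs 𝔽 n ] ⟦ v ==ᵥ e ∘ Fin.suc ⟧)
      ≡⟨ ∑-cong (elems 𝔽) (λ a → trans (cong (⟦ a == e Fin.zero ⟧ *_) (∑-Vecs-δ n (e ∘ Fin.suc)))
                                       (ℕₚ.*-identityʳ _)) ⟩
    ∑[ a ∈ elems 𝔽 ] ⟦ a == e Fin.zero ⟧
      ≡⟨ ∑-elems-δ (e Fin.zero) ⟩
    1 ∎
    where open ≡-Reasoning

  ∑-Vecs-δ-* : ∀ n (e : Vector F n) (g : Vector F n → ℕ) → Extensional g →
    ∑[ x ∈ Vecs 𝔽 n ] (⟦ x ==ᵥ e ⟧ * g x) ≡ g e
  ∑-Vecs-δ-* n e g ext = begin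
    ∑[ x ∈ Vecs 𝔽 n ] (⟦ x ==ᵥ e ⟧ * g x) ≡⟨ ∑-cong (Vecs 𝔽 n) at-e ⟩
    ∑[ x ∈ Vecs 𝔽 n ] (⟦ x ==ᵥ e ⟧ * g e) ≡⟨ ∑-distribʳ-* (Vecs 𝔽 n) (g e) _ ⟩
    ∑[ x ∈ Vecs 𝔽 n ] ⟦ x ==ᵥ e ⟧ * g e   ≡⟨ cong (_* g e) (∑-Vecs-δ n e) ⟩
    1 * g e                               ≡⟨ ℕₚ.*-identityˡ (g e) ⟩
    g e                                   ∎
    where
    open ≡-Reasoning
    at-e : ∀ x → ⟦ x ==ᵥ e ⟧ * g x ≡ ⟦ x ==ᵥ e ⟧ * g e
    at-e x with x ==ᵥ e in x==e
    ... | true  = cong (_+ 0) (ext x e (==ᵥ⇒≗ x e x==e))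
    ... | false = refl

  count : ∀ {n} → (Vector F n → Bool) → ℕ
  count {n} p = ∑[ x ∈ Vecs 𝔽 n ] ⟦ p x ⟧

  count-pos : ∀ {n} (p : Vector F n → Bool) → Extensional p → ∀ e → p e ≡ true → 1 ≤ count p
  count-pos {n} p ext e pe = begin
    1                                    ≡⟨ cong ⟦_⟧ pe ⟨
    ⟦ p e ⟧                              ≡⟨ ∑-Vecs-δ-* n e (⟦_⟧ ∘ p) (λ x y x≗y → cong ⟦_⟧ (ext x y x≗y)) ⟨
    ∑[ x ∈ Vecs 𝔽 n ] (⟦ x ==ᵥ e ⟧ * ⟦ p x ⟧) ≤⟨ ∑-mono-≤ (Vecs 𝔽 n) (λ x → *-≤ (x ==ᵥ e) ⟦ p x ⟧) ⟩
    count p                              ∎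
    where
    open ℕₚ.≤-Reasoning
    *-≤ : ∀ b m → ⟦ b ⟧ * m ≤ m
    *-≤ true  m = ℕₚ.≤-reflexive (ℕₚ.+-identityʳ m)
    *-≤ false m = z≤n

  count≡0⇒false : ∀ {n} (p : Vector F n → Bool) → Extensional p → count p ≡ 0 → ∀ e → p e ≡ false
  count≡0⇒false p ext p≡0 e with p e in pe
  ... | false = refl
  ... | true  = ⊥-elim (ℕₚ.<⇒≢ (count-pos p ext e pe) (sym p≡0))

  ∑-fibres : ∀ {X : Set} (L : List X) (Q : X → Bool) (f : X → F) →
    ∑[ x ∈ L ] ⟦ Q x ⟧ ≡ ∑[ b ∈ elems 𝔽 ] ∑[ x ∈ L ] ⟦ Q x ∧ (f x == b) ⟧
  ∑-fibres L Q f = sym (trans (∑-comm (elems 𝔽) L _) (∑-cong L fibre))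
    where
    fibre : ∀ x → ∑[ b ∈ elems 𝔽 ] ⟦ Q x ∧ (f x == b) ⟧ ≡ ⟦ Q x ⟧
    fibre x = begin
      ∑[ b ∈ elems 𝔽 ] ⟦ Q x ∧ (f x == b) ⟧      ≡⟨ ∑-cong (elems 𝔽) (λ b →
                                                       trans (⟦∧⟧ (Q x) _) (cong (λ c → ⟦ Q x ⟧ * ⟦ c ⟧) (==-sym (f x) b))) ⟩
      ∑[ b ∈ elems 𝔽 ] (⟦ Q x ⟧ * ⟦ b == f x ⟧) ≡⟨ ∑-distribˡ-* (elems 𝔽) ⟦ Q x ⟧ _ ⟩
      ⟦ Q x ⟧ * ∑[ b ∈ elems 𝔽 ] ⟦ b == f x ⟧   ≡⟨ cong (⟦ Q x ⟧ *_) (∑-elems-δ (f x)) ⟩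
      ⟦ Q x ⟧ * 1                              ≡⟨ ℕₚ.*-identityʳ _ ⟩
      ⟦ Q x ⟧                                  ∎
      where open ≡-Reasoning

  -- Expanding ⟦ p (x +ᵥ y) ⟧ into deltas, the substitution z = x +ᵥ y has exactly one
  -- solution x for each z.
  count-translate : ∀ {n} (p : Vector F n → Bool) → Extensional p → (y : Vector F n) →
    count (λ x → p (x +ᵥ y)) ≡ count p
  count-translate {n} p ext y = begin
    ∑[ x ∈ Vecs 𝔽 n ] ⟦ p (x +ᵥ y) ⟧
      ≡⟨ ∑-cong (Vecs 𝔽 n) (λ x → ∑-Vecs-δ-* n (x +ᵥ y) (⟦_⟧ ∘ p) (λ a b a≗b → cong ⟦_⟧ (ext a b a≗b))) ⟨
    ∑[ x ∈ Vecs 𝔽 n ] ∑[ z ∈ Vecs 𝔽 n ] (⟦ z ==ᵥ x +ᵥ y ⟧ * ⟦ p z ⟧)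
      ≡⟨ ∑-comm (Vecs 𝔽 n) (Vecs 𝔽 n) _ ⟩
    ∑[ z ∈ Vecs 𝔽 n ] ∑[ x ∈ Vecs 𝔽 n ] (⟦ z ==ᵥ x +ᵥ y ⟧ * ⟦ p z ⟧)
      ≡⟨ ∑-cong (Vecs 𝔽 n) (λ z → ∑-distribʳ-* (Vecs 𝔽 n) ⟦ p z ⟧ _) ⟩
    ∑[ z ∈ Vecs 𝔽 n ] (∑[ x ∈ Vecs 𝔽 n ] ⟦ z ==ᵥ x +ᵥ y ⟧ * ⟦ p z ⟧)
      ≡⟨ ∑-cong (Vecs 𝔽 n) (λ z → cong (_* ⟦ p z ⟧) (trans (∑-cong (Vecs 𝔽 n) (λ x → cong ⟦_⟧ (shift-==ᵥ z x)))
                                                         (∑-Vecs-δ n (λ t → z t +ᶠ -ᶠ y t)))) ⟩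
    ∑[ z ∈ Vecs 𝔽 n ] (1 * ⟦ p z ⟧)
      ≡⟨ ∑-cong (Vecs 𝔽 n) (λ z → ℕₚ.*-identityˡ ⟦ p z ⟧) ⟩
    count p ∎
    where
    open ≡-Reasoning
    shift-==ᵥ : ∀ z x → (z ==ᵥ x +ᵥ y) ≡ (x ==ᵥ λ t → z t +ᶠ -ᶠ y t)
    shift-==ᵥ z x = true-ext
      (λ h → ≗⇒==ᵥ _ _ (λ t → trans (sym (//-rightDividesʳ (y t) (x t)))
                                     (cong (_+ᶠ -ᶠ y t) (sym (==ᵥ⇒≗ _ _ h t)))))
      (λ h → ≗⇒==ᵥ _ _ (λ t → sym (trans (cong (_+ᶠ y t) (==ᵥ⇒≗ _ _ h t))
                                          (//-rightDividesˡ (y t) (z t)))))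

  record IsSubspace {n} (P : Vector F n → Bool) : Set where
    field
      extensional : Extensional P
      zero∈       : P 0ᵥ ≡ true
      +-closed    : ∀ x y → P x ≡ true → P y ≡ true → P (x +ᵥ y) ≡ true
      ·-closed    : ∀ c x → P x ≡ true → P (c ·ᵥ x) ≡ true

    +-invariant : ∀ x y → P y ≡ true → P (x +ᵥ y) ≡ P x
    +-invariant x y Py = true-ext (λ h → subtract h) (λ h → +-closed x y h Py)
      where
      subtract : P (x +ᵥ y) ≡ true → P x ≡ true
      subtract h = trans (extensional x _ (λ t → sym (begin
        (x t +ᶠ y t) +ᶠ (-ᶠ 1#) *ᶠ y t ≡⟨ cong (x t +ᶠ y t +ᶠ_) (-1*x≈-x (y t)) ⟩
        (x t +ᶠ y t) +ᶠ -ᶠ y t         ≡⟨ //-rightDividesʳ (y t) (x t) ⟩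
        x t                            ∎)))
        (+-closed (x +ᵥ y) ((-ᶠ 1#) ·ᵥ y) h (·-closed (-ᶠ 1#) y Py))
        where open ≡-Reasoning

-- Kernels of matrices

allᵇ-cong : {X : Set} (L : List X) {g h : X → Bool} → (∀ x → g x ≡ h x) → allᵇ g L ≡ allᵇ h L
allᵇ-cong []      e = refl
allᵇ-cong (x ∷ L) e = cong₂ _∧_ (e x) (allᵇ-cong L e)

allᵇ-tabulate : {X : Set} → ∀ n (f : Fin n → X) (g : X → Bool) → allᵇ g (tabulate f) ≡ allᵇ (g ∘ f) (allFin n)
allᵇ-tabulate zero    f g = refl
allᵇ-tabulate (suc n) f g = cong (g (f Fin.zero) ∧_)
  (trans (allᵇ-tabulate n (f ∘ Fin.suc) g) (sym (allᵇ-tabulate n Fin.suc (g ∘ f))))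

allᵇ-allFin-suc : ∀ n (g : Fin (suc n) → Bool) →
  allᵇ g (allFin (suc n)) ≡ g Fin.zero ∧ allᵇ (g ∘ Fin.suc) (allFin n)
allᵇ-allFin-suc n g = cong (g Fin.zero ∧_) (allᵇ-tabulate n Fin.suc g)

allᵇ-allFin⇒ : ∀ n (g : Fin n → Bool) → allᵇ g (allFin n) ≡ true → ∀ r → g r ≡ true
allᵇ-allFin⇒ (suc n) g h r with ∧≡true⇒ {g Fin.zero} (trans (sym (allᵇ-allFin-suc n g)) h) | r
... | g0 , _    | Fin.zero  = g0
... | _  , rest | Fin.suc r = allᵇ-allFin⇒ n (g ∘ Fin.suc) rest r

⇒allᵇ-allFin : ∀ n (g : Fin n → Bool) → (∀ r → g r ≡ true) → allᵇ g (allFin n) ≡ true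
⇒allᵇ-allFin zero    g h = refl
⇒allᵇ-allFin (suc n) g h = trans (allᵇ-allFin-suc n g)
  (cong₂ _∧_ (h Fin.zero) (⇒allᵇ-allFin n (g ∘ Fin.suc) (h ∘ Fin.suc)))

allᵇ-allFin-+ : ∀ m k (g : Fin (m + k) → Bool) → allᵇ g (allFin (m + k)) ≡
  allᵇ (λ r → g (r ↑ˡ k)) (allFin m) ∧ allᵇ (λ s → g (m ↑ʳ s)) (allFin k)
allᵇ-allFin-+ zero    k g = refl
allᵇ-allFin-+ (suc m) k g = begin
  allᵇ g (allFin (suc m + k))
    ≡⟨ allᵇ-allFin-suc (m + k) g ⟩
  g Fin.zero ∧ allᵇ (g ∘ Fin.suc) (allFin (m + k))
    ≡⟨ cong (g Fin.zero ∧_) (allᵇ-allFin-+ m k (g ∘ Fin.suc)) ⟩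
  g Fin.zero ∧ (allᵇ (λ r → g (Fin.suc (r ↑ˡ k))) (allFin m) ∧ allᵇ (λ s → g (suc m ↑ʳ s)) (allFin k))
    ≡⟨ Boolₚ.∧-assoc (g Fin.zero) _ _ ⟨
  (g Fin.zero ∧ allᵇ (λ r → g (Fin.suc r ↑ˡ k)) (allFin m)) ∧ allᵇ (λ s → g (suc m ↑ʳ s)) (allFin k)
    ≡⟨ cong (_∧ allᵇ (λ s → g (suc m ↑ʳ s)) (allFin k)) (allᵇ-allFin-suc m (λ r → g (r ↑ˡ k))) ⟨
  allᵇ (λ r → g (r ↑ˡ k)) (allFin (suc m)) ∧ allᵇ (λ s → g (suc m ↑ʳ s)) (allFin k) ∎
  where open ≡-Reasoning

module Kernel (𝔽 : FiniteField) where

  open Field 𝔽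

  sumF-cong : ∀ n {f g : Fin n → F} → f ≗ g → sumF 𝔽 n f ≡ sumF 𝔽 n g
  sumF-cong zero    e = refl
  sumF-cong (suc n) e = cong₂ _+ᶠ_ (e Fin.zero) (sumF-cong n (e ∘ Fin.suc))

  sumF-zero : ∀ n → sumF 𝔽 n (λ _ → 0#) ≡ 0#
  sumF-zero zero    = refl
  sumF-zero (suc n) = trans (cong (0# +ᶠ_) (sumF-zero n)) (+-identityʳ 0#)

  sumF-+ : ∀ n (f g : Fin n → F) → sumF 𝔽 n (λ t → f t +ᶠ g t) ≡ sumF 𝔽 n f +ᶠ sumF 𝔽 n g
  sumF-+ zero    f g = sym (+-identityʳ 0#)
  sumF-+ (suc n) f g = trans (cong (f Fin.zero +ᶠ g Fin.zero +ᶠ_) (sumF-+ n (f ∘ Fin.suc) (g ∘ Fin.suc)))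
    (+ᶠ-interchange (f Fin.zero) (g Fin.zero) _ _)
    where open import Algebra.Properties.CommutativeSemigroup (CommutativeRing.+-commutativeSemigroup commutativeRing)
            using () renaming (interchange to +ᶠ-interchange)

  sumF-*ˡ : ∀ n c (f : Fin n → F) → sumF 𝔽 n (λ t → c *ᶠ f t) ≡ c *ᶠ sumF 𝔽 n f
  sumF-*ˡ zero    c f = sym (zeroʳ c)
  sumF-*ˡ (suc n) c f = trans (cong (c *ᶠ f Fin.zero +ᶠ_) (sumF-*ˡ n c (f ∘ Fin.suc))) (sym (distribˡ c _ _))

  sumF-δ : ∀ n (i : Fin n) (x : Vector F n) → sumF 𝔽 n (λ t → (if ⌊ i ≟ᶠ t ⌋ then 1# else 0#) *ᶠ x t) ≡ x i
  sumF-δ (suc n) Fin.zero x = begin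
    1# *ᶠ x Fin.zero +ᶠ sumF 𝔽 n (λ t → 0# *ᶠ x (Fin.suc t)) ≡⟨ cong₂ _+ᶠ_ (*-identityˡ _) (trans (sumF-cong n (λ t → zeroˡ _)) (sumF-zero n)) ⟩
    x Fin.zero +ᶠ 0#                                         ≡⟨ +-identityʳ _ ⟩
    x Fin.zero                                               ∎
    where open ≡-Reasoning
  sumF-δ (suc n) (Fin.suc i) x = begin
    0# *ᶠ x Fin.zero +ᶠ sumF 𝔽 n (λ t → (if ⌊ Fin.suc i ≟ᶠ Fin.suc t ⌋ then 1# else 0#) *ᶠ x (Fin.suc t))
      ≡⟨ cong₂ _+ᶠ_ (zeroˡ _) (sumF-cong n (λ t → cong (λ b → (if b then 1# else 0#) *ᶠ x (Fin.suc t))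
                                                      (⌊⌋-cong suc-injective (cong Fin.suc) _ (i ≟ᶠ t)))) ⟩
    0# +ᶠ sumF 𝔽 n (λ t → (if ⌊ i ≟ᶠ t ⌋ then 1# else 0#) *ᶠ x (Fin.suc t))
      ≡⟨ trans (+-identityˡ _) (sumF-δ n i (x ∘ Fin.suc)) ⟩
    x (Fin.suc i) ∎
    where open ≡-Reasoning

  module _ {m n : ℕ} (B : Matrix 𝔽 m n) where

    inKer⇒ : ∀ x → inKer 𝔽 B x ≡ true → ∀ r → sumF 𝔽 n (λ t → B r t *ᶠ x t) ≡ 0#
    inKer⇒ x h r = ⌊⌋≡true⇒ (_ ≟ 0#) (allᵇ-allFin⇒ m _ (trans (sym (allᵇ-tabulate m id _)) h) r)

    ⇒inKer : ∀ x → (∀ r → sumF 𝔽 n (λ t → B r t *ᶠ x t) ≡ 0#) → inKer 𝔽 B x ≡ true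
    ⇒inKer x h = trans (allᵇ-tabulate m id _) (⇒allᵇ-allFin m _ (λ r → ⇒⌊⌋≡true (_ ≟ 0#) (h r)))

    kernel-isSubspace : IsSubspace (inKer 𝔽 B)
    kernel-isSubspace = record
      { extensional = λ x y x≗y → true-ext
          (λ h → ⇒inKer y (λ r → trans (sumF-cong n (λ t → cong (B r t *ᶠ_) (sym (x≗y t)))) (inKer⇒ x h r)))
          (λ h → ⇒inKer x (λ r → trans (sumF-cong n (λ t → cong (B r t *ᶠ_) (x≗y t))) (inKer⇒ y h r)))
      ; zero∈ = ⇒inKer 0ᵥ (λ r → trans (sumF-cong n (λ t → zeroʳ (B r t))) (sumF-zero n))
      ; +-closed = λ x y hx hy → ⇒inKer (x +ᵥ y) (λ r → begin
          sumF 𝔽 n (λ t → B r t *ᶠ (x t +ᶠ y t))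
            ≡⟨ trans (sumF-cong n (λ t → distribˡ (B r t) (x t) (y t))) (sumF-+ n _ _) ⟩
          sumF 𝔽 n (λ t → B r t *ᶠ x t) +ᶠ sumF 𝔽 n (λ t → B r t *ᶠ y t)
            ≡⟨ cong₂ _+ᶠ_ (inKer⇒ x hx r) (inKer⇒ y hy r) ⟩
          0# +ᶠ 0#
            ≡⟨ +-identityʳ 0# ⟩
          0# ∎)
      ; ·-closed = λ c x hx → ⇒inKer (c ·ᵥ x) (λ r → begin
          sumF 𝔽 n (λ t → B r t *ᶠ (c *ᶠ x t))
            ≡⟨ sumF-cong n (λ t → *-left-commutative (B r t) c (x t)) ⟩
          sumF 𝔽 n (λ t → c *ᶠ (B r t *ᶠ x t))
            ≡⟨ sumF-*ˡ n c _ ⟩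
          c *ᶠ sumF 𝔽 n (λ t → B r t *ᶠ x t)
            ≡⟨ cong (c *ᶠ_) (inKer⇒ x hx r) ⟩
          c *ᶠ 0#
            ≡⟨ zeroʳ c ⟩
          0# ∎)
      }
      where
      open ≡-Reasoning
      *-left-commutative : ∀ a b c → a *ᶠ (b *ᶠ c) ≡ b *ᶠ (a *ᶠ c)
      *-left-commutative a b c = trans (sym (*-assoc a b c)) (trans (cong (_*ᶠ c) (*-comm a b)) (*-assoc b a c))

  inKer-append : ∀ {m n k} (A : Matrix 𝔽 m n) (v : Fin k → Fin n) (x : Vector F n) →
    inKer 𝔽 (append 𝔽 A v) x ≡ inKer 𝔽 A x ∧ allᵇ (λ s → x (v s) == 0#) (allFin k)
  inKer-append {m} {n} {k} A v x = begin
    inKer 𝔽 (append 𝔽 A v) x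
      ≡⟨ allᵇ-tabulate (m + k) id _ ⟩
    allᵇ (λ r → row (append 𝔽 A v r)) (allFin (m + k))
      ≡⟨ allᵇ-allFin-+ m k _ ⟩
    allᵇ (λ r → row (append 𝔽 A v (r ↑ˡ k))) (allFin m) ∧ allᵇ (λ s → row (append 𝔽 A v (m ↑ʳ s))) (allFin k)
      ≡⟨ cong₂ _∧_ (trans (allᵇ-cong (allFin m) upper) (sym (allᵇ-tabulate m id _))) (allᵇ-cong (allFin k) lower) ⟩
    inKer 𝔽 A x ∧ allᵇ (λ s → x (v s) == 0#) (allFin k) ∎
    where
    open ≡-Reasoning
    row : Vector F n → Bool
    row a = sumF 𝔽 n (λ t → a t *ᶠ x t) == 0#
    upper : ∀ r → row (append 𝔽 A v (r ↑ˡ k)) ≡ row (A r)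
    upper r rewrite splitAt-↑ˡ m r k = refl
    lower : ∀ s → row (append 𝔽 A v (m ↑ʳ s)) ≡ (x (v s) == 0#)
    lower s rewrite splitAt-↑ʳ m k s = cong (_== 0#) (sumF-δ n (v s) x)

  inKer-append-∷ : ∀ {m n k} (A : Matrix 𝔽 m n) (i : Fin n) (v : Fin k → Fin n) (x : Vector F n) →
    inKer 𝔽 (append 𝔽 A (i VF.∷ v)) x ≡ inKer 𝔽 (append 𝔽 A v) x ∧ (x i == 0#)
  inKer-append-∷ {k = k} A i v x = begin
    inKer 𝔽 (append 𝔽 A (i VF.∷ v)) x
      ≡⟨ trans (inKer-append A (i VF.∷ v) x) (cong (inKer 𝔽 A x ∧_) (allᵇ-allFin-suc k _)) ⟩
    inKer 𝔽 A x ∧ ((x i == 0#) ∧ allᵇ (λ s → x (v s) == 0#) (allFin k))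
      ≡⟨ cong (inKer 𝔽 A x ∧_) (Boolₚ.∧-comm (x i == 0#) _) ⟩
    inKer 𝔽 A x ∧ (allᵇ (λ s → x (v s) == 0#) (allFin k) ∧ (x i == 0#))
      ≡⟨ Boolₚ.∧-assoc (inKer 𝔽 A x) _ _ ⟨
    (inKer 𝔽 A x ∧ allᵇ (λ s → x (v s) == 0#) (allFin k)) ∧ (x i == 0#)
      ≡⟨ cong (_∧ (x i == 0#)) (inKer-append A v x) ⟨
    inKer 𝔽 (append 𝔽 A v) x ∧ (x i == 0#) ∎
    where open ≡-Reasoning

-- Frozen and linked coordinates of a subspace

module Coordinates (𝔽 : FiniteField) where

  open Field 𝔽

  count-cong : ∀ {n} {p p′ : Vector F n → Bool} → (∀ x → p x ≡ p′ x) → count p ≡ count p′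
  count-cong {n} e = ∑-cong (Vecs 𝔽 n) (λ x → cong ⟦_⟧ (e x))

  count≢0⇒∃ : ∀ {n} (p : Vector F n → Bool) → ¬ count p ≡ 0 → ∃ λ x → p x ≡ true
  count≢0⇒∃ {n} p h with ∑≢0⇒∃≢0 (Vecs 𝔽 n) (⟦_⟧ ∘ p) h
  ... | x , px≢0 = x , ⟦⟧≢0⇒true px≢0

  module _ {n : ℕ} (P : Vector F n → Bool) where

    count₁ : Fin n → F → ℕ
    count₁ i a = count (λ x → (x i == a) ∧ P x)

    count₂ : Fin n → Fin n → F → F → ℕ
    count₂ i j a b = count (λ x → ((x i == a) ∧ (x j == b)) ∧ P x)

    frozen : Fin n → Bool
    frozen i = ⌊ count (λ x → P x ∧ not (x i == 0#)) ℕ.≟ 0 ⌋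

    forces-zero : Fin n → Fin n → Bool
    forces-zero i j = ⌊ count (λ x → P x ∧ ((x i == 0#) ∧ not (x j == 0#))) ℕ.≟ 0 ⌋

    linked : Fin n → Fin n → Bool
    linked i j = not (frozen i) ∧ (not (frozen j) ∧ forces-zero i j)

    linkedPairs : ℕ
    linkedPairs = ∑[ ij ∈ pairs 𝔽 n ] ⟦ linked (proj₁ ij) (proj₂ ij) ⟧

  module _ {n : ℕ} {P : Vector F n → Bool} where

    count₂-comm : ∀ i j a b → count₂ P i j a b ≡ count₂ P j i b a
    count₂-comm i j a b = count-cong (λ x → cong (_∧ P x) (Boolₚ.∧-comm (x i == a) (x j == b)))

    count-fibres : ∀ i → count P ≡ ∑[ a ∈ elems 𝔽 ] count₁ P i a
    count-fibres i = trans (∑-fibres (Vecs 𝔽 n) P (λ x → x i))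
      (∑-cong (elems 𝔽) (λ a → count-cong (λ x → Boolₚ.∧-comm (P x) (x i == a))))

    count₁-fibres : ∀ i j a → count₁ P i a ≡ ∑[ b ∈ elems 𝔽 ] count₂ P i j a b
    count₁-fibres i j a = trans (∑-fibres (Vecs 𝔽 n) (λ x → (x i == a) ∧ P x) (λ x → x j))
      (∑-cong (elems 𝔽) (λ b → count-cong (λ x → rearrange (x i == a) (P x) (x j == b))))
      where
      rearrange : ∀ a p b → (a ∧ p) ∧ b ≡ (a ∧ b) ∧ p
      rearrange a p b = trans (Boolₚ.∧-assoc a p b) (trans (cong (a ∧_) (Boolₚ.∧-comm p b)) (sym (Boolₚ.∧-assoc a b p)))

    frozen⇒≡0 : IsSubspace P → ∀ i → frozen P i ≡ true → ∀ x → P x ≡ true → x i ≡ 0#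
    frozen⇒≡0 sp i fi x Px = ⌊⌋≡true⇒ (x i ≟ 0#) (Boolₚ.not-injective (begin
      not (x i == 0#)           ≡⟨ cong (_∧ not (x i == 0#)) Px ⟨
      P x ∧ not (x i == 0#)     ≡⟨ count≡0⇒false _ nonzero-extensional (⌊⌋≡true⇒ (_ ℕ.≟ 0) fi) x ⟩
      false                     ∎))
      where
      open ≡-Reasoning
      nonzero-extensional : Extensional (λ x → P x ∧ not (x i == 0#))
      nonzero-extensional x y x≗y =
        cong₂ _∧_ (IsSubspace.extensional sp x y x≗y) (cong (λ c → not (c == 0#)) (x≗y i))

    unfrozen⇒∃ : ∀ i → frozen P i ≡ false → ∃ λ w → P w ≡ true × ¬ w i ≡ 0#
    unfrozen⇒∃ i fi with count≢0⇒∃ _ (⌊⌋≡false⇒ (_ ℕ.≟ 0) fi)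
    ... | w , h with ∧≡true⇒ {P w} h
    ...   | Pw , wi≢0 = w , Pw , ⌊⌋≡false⇒ (w i ≟ 0#) (Boolₚ.not-injective wi≢0)

    ¬forces-zero⇒∃ : ∀ i j → forces-zero P i j ≡ false → ∃ λ z → P z ≡ true × z i ≡ 0# × ¬ z j ≡ 0#
    ¬forces-zero⇒∃ i j h with count≢0⇒∃ _ (⌊⌋≡false⇒ (_ ℕ.≟ 0) h)
    ... | z , h′ with ∧≡true⇒ {P z} h′
    ...   | Pz , h″ with ∧≡true⇒ {z i == 0#} h″
    ...     | zi≡0 , zj≢0 = z , Pz , ⌊⌋≡true⇒ (z i ≟ 0#) zi≡0 , ⌊⌋≡false⇒ (z j ≟ 0#) (Boolₚ.not-injective zj≢0)

  count-const-coordinate : ∀ {n} (Q : Vector F n → Bool) i → (∀ x → Q x ≡ true → x i ≡ 0#) →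
    ∀ a → count (λ x → (x i == a) ∧ Q x) ≡ ⟦ 0# == a ⟧ * count Q
  count-const-coordinate {n} Q i Q⇒0 a =
    trans (∑-cong (Vecs 𝔽 n) pointwise) (∑-distribˡ-* (Vecs 𝔽 n) ⟦ 0# == a ⟧ (⟦_⟧ ∘ Q))
    where
    pointwise : ∀ x → ⟦ (x i == a) ∧ Q x ⟧ ≡ ⟦ 0# == a ⟧ * ⟦ Q x ⟧
    pointwise x with Q x in Qx
    ... | true  = trans (cong (λ c → ⟦ (c == a) ∧ true ⟧) (Q⇒0 x Qx)) (⟦∧⟧ (0# == a) true)
    ... | false = trans (cong ⟦_⟧ (Boolₚ.∧-zeroʳ (x i == a))) (sym (ℕₚ.*-zeroʳ ⟦ 0# == a ⟧))

  module _ {n : ℕ} {P : Vector F n → Bool} (sp : IsSubspace P) where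

    open IsSubspace sp

    projection-surjective : ∀ i j w → P w ≡ true → ¬ w i ≡ 0# → ∀ z → P z ≡ true → z i ≡ 0# → ¬ z j ≡ 0# →
      ∀ a b → ∃ λ y → P y ≡ true × y i ≡ a × y j ≡ b
    projection-surjective i j w Pw wi≢0 z Pz zi≡0 zj≢0 a b = y , Py , yi≡a , yj≡b
      where
      wi⁻¹ = proj₁ (inv (w i) wi≢0)
      zj⁻¹ = proj₁ (inv (z j) zj≢0)
      α = a *ᶠ wi⁻¹
      β = (b +ᶠ -ᶠ (α *ᶠ w j)) *ᶠ zj⁻¹
      y = α ·ᵥ w +ᵥ β ·ᵥ z
      Py : P y ≡ true
      Py = +-closed _ _ (·-closed α w Pw) (·-closed β z Pz)
      cancel : ∀ c u u⁻¹ → u *ᶠ u⁻¹ ≡ 1# → c *ᶠ u⁻¹ *ᶠ u ≡ c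
      cancel c u u⁻¹ h = trans (*-assoc c u⁻¹ u) (trans (cong (c *ᶠ_) (trans (*-comm u⁻¹ u) h)) (*-identityʳ c))
      yi≡a : y i ≡ a
      yi≡a = begin
        α *ᶠ w i +ᶠ β *ᶠ z i ≡⟨ cong₂ _+ᶠ_ (cancel a (w i) wi⁻¹ (proj₂ (inv (w i) wi≢0))) (trans (cong (β *ᶠ_) zi≡0) (zeroʳ β)) ⟩
        a +ᶠ 0#              ≡⟨ +-identityʳ a ⟩
        a                    ∎
        where open ≡-Reasoning
      yj≡b : y j ≡ b
      yj≡b = begin
        α *ᶠ w j +ᶠ β *ᶠ z j            ≡⟨ cong (α *ᶠ w j +ᶠ_) (cancel _ (z j) zj⁻¹ (proj₂ (inv (z j) zj≢0))) ⟩
        α *ᶠ w j +ᶠ (b +ᶠ -ᶠ (α *ᶠ w j)) ≡⟨ +-comm (α *ᶠ w j) _ ⟩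
        b +ᶠ -ᶠ (α *ᶠ w j) +ᶠ α *ᶠ w j   ≡⟨ //-rightDividesˡ (α *ᶠ w j) b ⟩
        b                              ∎
        where open ≡-Reasoning

    count₂-translate : ∀ i j y → P y ≡ true → count₂ P i j (y i) (y j) ≡ count₂ P i j 0# 0#
    count₂-translate i j y Py = trans (sym (count-translate p p-extensional y)) (count-cong shifted)
      where
      p : Vector F n → Bool
      p x = ((x i == y i) ∧ (x j == y j)) ∧ P x
      p-extensional : Extensional p
      p-extensional x x′ x≗x′ =
        cong₂ _∧_ (cong₂ _∧_ (cong (_== y i) (x≗x′ i)) (cong (_== y j) (x≗x′ j))) (extensional x x′ x≗x′)
      ==-shift : ∀ u c → (u +ᶠ c == c) ≡ (u == 0#)
      ==-shift u c = ⌊⌋-cong (λ h → trans (sym (//-rightDividesʳ c u)) (trans (cong (_+ᶠ -ᶠ c) h) (-‿inverseʳ c)))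
                             (λ h → trans (cong (_+ᶠ c) h) (+-identityˡ c)) _ _
      shifted : ∀ x → p (x +ᵥ y) ≡ ((x i == 0#) ∧ (x j == 0#)) ∧ P x
      shifted x = cong₂ _∧_ (cong₂ _∧_ (==-shift (x i) (y i)) (==-shift (x j) (y j))) (+-invariant x y Py)

    frozen⇒independent : ∀ i j → frozen P i ≡ true → ∀ a b →
      count₂ P i j a b * count P ≡ count₁ P i a * count₁ P j b
    frozen⇒independent i j fi a b = begin
      count₂ P i j a b * count P                  ≡⟨ cong (_* count P) (trans (count-cong (λ x → Boolₚ.∧-assoc (x i == a) _ _))
                                                      (count-const-coordinate (λ x → (x j == b) ∧ P x) i (λ x h → i≡0 x (proj₂ (∧≡true⇒ h))) a)) ⟩
      ⟦ 0# == a ⟧ * count₁ P j b * count P          ≡⟨ ℕₚ.*-assoc ⟦ 0# == a ⟧ _ _ ⟩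
      ⟦ 0# == a ⟧ * (count₁ P j b * count P)        ≡⟨ cong (⟦ 0# == a ⟧ *_) (ℕₚ.*-comm _ (count P)) ⟩
      ⟦ 0# == a ⟧ * (count P * count₁ P j b)        ≡⟨ ℕₚ.*-assoc ⟦ 0# == a ⟧ _ _ ⟨
      ⟦ 0# == a ⟧ * count P * count₁ P j b          ≡⟨ cong (_* count₁ P j b) (count-const-coordinate P i i≡0 a) ⟨
      count₁ P i a * count₁ P j b                  ∎
      where
      open ≡-Reasoning
      i≡0 = frozen⇒≡0 sp i fi

    unlinked⇒independent : ∀ i j → linked P i j ≡ false → ∀ a b →
      count₂ P i j a b * count P ≡ count₁ P i a * count₁ P j b
    unlinked⇒independent i j unlinked a b with frozen P i in fi
    ... | true  = frozen⇒independent i j fi a b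
    ... | false with frozen P j in fj
    ...   | true  = trans (cong (_* count P) (count₂-comm i j a b))
                          (trans (frozen⇒independent j i fj b a) (ℕₚ.*-comm (count₁ P j b) _))
    -- Both coordinates are free and unlinked, so (x i , x j) is uniform on F × F.
    ...   | false with unfrozen⇒∃ i fi | ¬forces-zero⇒∃ i j unlinked
    ...     | w , Pw , wi≢0 | z , Pz , zi≡0 , zj≢0 = begin
      count₂ P i j a b * count P       ≡⟨ cong₂ _*_ (uniform a b) count≡q²N ⟩
      N * (q * (q * N))                 ≡⟨ rearrange N q ⟩
      q * N * (q * N)                   ≡⟨ cong₂ _*_ count₁ᵢ≡qN count₁ⱼ≡qN ⟨
      count₁ P i a * count₁ P j b      ∎
      where
      open ≡-Reasoning
      N = count₂ P i j 0# 0#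
      rearrange : ∀ N q → N * (q * (q * N)) ≡ q * N * (q * N)
      rearrange = solve-∀
      uniform : ∀ a b → count₂ P i j a b ≡ N
      uniform a b with projection-surjective i j w Pw wi≢0 z Pz zi≡0 zj≢0 a b
      ... | y , Py , refl , refl = count₂-translate i j y Py
      ∑-elems-const : ∀ {g : F → ℕ} {c} → (∀ a → g a ≡ c) → ∑ (elems 𝔽) g ≡ q * c
      ∑-elems-const {g} {c} h = trans (∑-cong (elems 𝔽) h) (trans (∑-const (elems 𝔽) c) (cong (_* c) length-elems))
      count₁ᵢ≡qN : count₁ P i a ≡ q * N
      count₁ᵢ≡qN = trans (count₁-fibres i j a) (∑-elems-const (uniform a))
      count₁ⱼ≡qN : count₁ P j b ≡ q * N
      count₁ⱼ≡qN = trans (count₁-fibres j i b) (∑-elems-const (λ a′ → trans (count₂-comm j i b a′) (uniform a′ b)))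
      count≡q²N : count P ≡ q * (q * N)
      count≡q²N = trans (count-fibres i)
        (∑-elems-const (λ a′ → trans (count₁-fibres i j a′) (∑-elems-const (uniform a′))))

-- Pairwise total variation of μ_B

sumℚ-uniform-filterᵇ : ∀ {X : Set} K .{{_ : NonZero K}} (L : List X) (Q P : X → Bool) →
  sumℚ (map (λ x → if P x then ratio 1 K else 0ℚ) (filterᵇ Q L)) ≡ ratio (∑[ x ∈ L ] ⟦ Q x ∧ P x ⟧) K
sumℚ-uniform-filterᵇ K []      Q P = sym (ratio-zero K)
sumℚ-uniform-filterᵇ K (x ∷ L) Q P with Q x
... | false = sumℚ-uniform-filterᵇ K L Q P
... | true with P x
...   | true  = trans (cong (ratio 1 K ℚ.+_) (sumℚ-uniform-filterᵇ K L Q P)) (ratio-+-sameDenom 1 K _)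
...   | false = trans (ℚₚ.+-identityˡ _) (sumℚ-uniform-filterᵇ K L Q P)

module _ (K : ℕ) .{{_ : NonZero K}} where

  dependence : ℕ → ℕ → ℕ → ℚ
  dependence c₂ c c′ = ℚ.∣ ratio c₂ K ℚ.- ratio c K ℚ.* ratio c′ K ∣

  dependence-zero : ∀ c₂ c c′ → c₂ * K ≡ c * c′ → dependence c₂ c c′ ≡ 0ℚ
  dependence-zero c₂ c c′ h = trans (cong (λ z → ℚ.∣ ratio c₂ K ℚ.- z ∣) product≡ratio)
                                    (cong ℚ.∣_∣ (ℚₚ.+-inverseʳ (ratio c₂ K)))
    where
    product≡ratio : ratio c K ℚ.* ratio c′ K ≡ ratio c₂ K
    product≡ratio = trans (ratio-* c K c′ K) (ratio-cong _ _ c₂ K {{ℕₚ.m*n≢0 K K}}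
      (trans (cong (_* K) (sym h)) (ℕₚ.*-assoc c₂ K K)))

  dependence≤2 : ∀ c₂ c c′ → c₂ ≤ K → c ≤ K → c′ ≤ K → dependence c₂ c c′ ℚ.≤ ratio 2 1
  dependence≤2 c₂ c c′ c₂≤K c≤K c′≤K = begin
    ℚ.∣ x ℚ.- y ∣      ≤⟨ ℚₚ.∣p-q∣≤∣p∣+∣q∣ x y ⟩
    ℚ.∣ x ∣ ℚ.+ ℚ.∣ y ∣ ≡⟨ cong₂ ℚ._+_ (ℚₚ.0≤p⇒∣p∣≡p (ratio-nonNeg c₂ K)) (ℚₚ.0≤p⇒∣p∣≡p 0≤y) ⟩
    x ℚ.+ y            ≤⟨ ℚₚ.+-mono-≤ (ratio≤1 c₂ K c₂≤K) y≤1 ⟩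
    1ℚ ℚ.+ 1ℚ          ≡⟨⟩
    ratio 2 1          ∎
    where
    open ℚₚ.≤-Reasoning
    x = ratio c₂ K
    y = ratio c K ℚ.* ratio c′ K
    0≤y : 0ℚ ℚ.≤ y
    0≤y = ℚₚ.≤-trans (ℚₚ.≤-reflexive (sym (ℚₚ.*-zeroˡ (ratio c′ K))))
                     (ℚₚ.*-monoʳ-≤-nonNeg (ratio c′ K) {{ℚ.nonNegative (ratio-nonNeg c′ K)}} (ratio-nonNeg c K))
    y≤1 : y ℚ.≤ 1ℚ
    y≤1 = ℚₚ.≤-trans (ℚₚ.*-monoʳ-≤-nonNeg (ratio c′ K) {{ℚ.nonNegative (ratio-nonNeg c′ K)}} (ratio≤1 c K c≤K))
                     (ℚₚ.≤-trans (ℚₚ.≤-reflexive (ℚₚ.*-identityˡ _)) (ratio≤1 c′ K c′≤K))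

module PairTV (𝔽 : FiniteField) where

  open Field 𝔽
  open Kernel 𝔽
  open Coordinates 𝔽

  module _ {m n : ℕ} (B : Matrix 𝔽 m n) where

    private
      P = inKer 𝔽 B
      K = length (kernel 𝔽 B)

    length-kernel : K ≡ count P
    length-kernel = length-filterᵇ (Vecs 𝔽 n) P

    count≤length-kernel : ∀ (Q : Vector F n → Bool) → count (λ x → Q x ∧ P x) ≤ K
    count≤length-kernel Q = ℕₚ.≤-trans (∑-mono-≤ (Vecs 𝔽 n) (λ x → ⟦∧⟧≤ʳ (Q x) (P x)))
                                       (ℕₚ.≤-reflexive (sym length-kernel))

    instance
      kernel-nonZero : NonZero K
      kernel-nonZero = ℕ.>-nonZero (subst (1 ≤_) (sym length-kernel)
        (count-pos P (IsSubspace.extensional (kernel-isSubspace B)) 0ᵥ (IsSubspace.zero∈ (kernel-isSubspace B))))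

    tvPair-μ : ∀ i j → tvPair 𝔽 (μ 𝔽 B) i j ≡
      ½ ℚ.* ∑ℚ[ a ∈ elems 𝔽 ] ∑ℚ[ b ∈ elems 𝔽 ] dependence K (count₂ P i j a b) (count₁ P i a) (count₁ P j b)
    tvPair-μ i j = cong (½ ℚ.*_) (trans (sumℚ-concatMap (elems 𝔽) _) (∑ℚ-cong (elems 𝔽) (λ a →
      ∑ℚ-cong (elems 𝔽) (λ b → cong₂ (λ u w → ℚ.∣ u ℚ.- w ∣)
        (sumℚ-uniform-filterᵇ K (Vecs 𝔽 n) (λ x → (x i == a) ∧ (x j == b)) P)
        (cong₂ ℚ._*_ (sumℚ-uniform-filterᵇ K (Vecs 𝔽 n) (λ x → x i == a) P)
                     (sumℚ-uniform-filterᵇ K (Vecs 𝔽 n) (λ x → x j == b) P))))))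

    tvPair≤ : ∀ i j → tvPair 𝔽 (μ 𝔽 B) i j ℚ.≤ ratio (q * q * ⟦ linked P i j ⟧) 1
    tvPair≤ i j with linked P i j in l
    ... | false = ℚₚ.≤-reflexive (begin-equality
      tvPair 𝔽 (μ 𝔽 B) i j ≡⟨ tvPair-μ i j ⟩
      ½ ℚ.* ∑ℚ[ a ∈ elems 𝔽 ] ∑ℚ[ b ∈ elems 𝔽 ] _
        ≡⟨ cong (½ ℚ.*_) (trans (∑ℚ-cong (elems 𝔽) (λ a → trans (∑ℚ-cong (elems 𝔽) (λ b →
             dependence-zero K _ _ _ (trans (cong (count₂ P i j a b *_) length-kernel)
               (unlinked⇒independent (kernel-isSubspace B) i j l a b)))) (∑ℚ-zero (elems 𝔽)))) (∑ℚ-zero (elems 𝔽))) ⟩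
      ½ ℚ.* 0ℚ             ≡⟨ ℚₚ.*-zeroʳ ½ ⟩
      0ℚ                   ≡⟨ ratio-zero 1 ⟨
      ratio 0 1            ≡⟨ cong (λ c → ratio c 1) (ℕₚ.*-zeroʳ (q * q)) ⟨
      ratio (q * q * 0) 1  ∎)
      where open ℚₚ.≤-Reasoning
    ... | true = begin
      tvPair 𝔽 (μ 𝔽 B) i j ≡⟨ tvPair-μ i j ⟩
      ½ ℚ.* ∑ℚ[ a ∈ elems 𝔽 ] ∑ℚ[ b ∈ elems 𝔽 ] _
        ≤⟨ ℚₚ.*-monoˡ-≤-nonNeg ½ (∑ℚ-mono-≤ (elems 𝔽) (λ a → ∑ℚ-mono-≤ (elems 𝔽) (λ b →
             dependence≤2 K _ _ _ (count≤length-kernel _) (count≤length-kernel _) (count≤length-kernel _)))) ⟩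
      ½ ℚ.* ∑ℚ[ a ∈ elems 𝔽 ] ∑ℚ[ b ∈ elems 𝔽 ] ratio 2 1
        ≡⟨ cong (½ ℚ.*_) (trans (∑ℚ-cong (elems 𝔽) (λ a → ∑ℚ-const 2)) (∑ℚ-const (q * 2))) ⟩
      ½ ℚ.* ratio (q * (q * 2)) 1
        ≡⟨ ratio-* 1 2 (q * (q * 2)) 1 ⟩
      ratio (1 * (q * (q * 2))) (2 * 1)
        ≡⟨ ratio-cong (1 * (q * (q * 2))) (2 * 1) (q * q * 1) 1 (rearrange q) ⟩
      ratio (q * q * 1) 1 ∎
      where
      open ℚₚ.≤-Reasoning
      ∑ℚ-const : ∀ c → ∑ℚ[ a ∈ elems 𝔽 ] ratio c 1 ≡ ratio (q * c) 1
      ∑ℚ-const c = trans (∑ℚ-ratio (elems 𝔽) (λ _ → c))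
                        (cong (λ z → ratio z 1) (trans (∑-const (elems 𝔽) c) (cong (_* c) length-elems)))
      rearrange : ∀ q → 1 * (q * (q * 2)) * 1 ≡ q * q * 1 * (2 * 1)
      rearrange = solve-∀

    ¬symmetric⇒ : ∀ ε p r .{{_ : NonZero r}} → ε ≡ ratio p r → symmetric2? 𝔽 ε (μ 𝔽 B) ≡ false →
      p * (n * n) ≤ r * (q * q * linkedPairs P)
    ¬symmetric⇒ ε p r refl ¬sym = subst₂ _≤_ (ℕₚ.*-identityʳ _) (ℕₚ.*-comm _ r)
      (ratio-cancel-≤ (p * (n * n)) r (q * q * linkedPairs P) 1 (begin
      ratio (p * (n * n)) r           ≡⟨ cong (ratio (p * (n * n))) (ℕₚ.*-identityʳ r) ⟨
      ratio (p * (n * n)) (r * 1)     ≡⟨ ratio-* p r (n * n) 1 ⟨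
      ratio p r ℚ.* ratio (n * n) 1   ≤⟨ ℚₚ.≮⇒≥ (⌊⌋≡false⇒ (_ ℚ.<? _) ¬sym) ⟩
      sumℚ (map _ (pairs 𝔽 n))
        ≤⟨ ∑ℚ-mono-≤ (pairs 𝔽 n) (λ { (i , j) → tvPair≤ i j }) ⟩
      ∑ℚ[ ij ∈ pairs 𝔽 n ] ratio (q * q * ⟦ linked P (proj₁ ij) (proj₂ ij) ⟧) 1
        ≡⟨ ∑ℚ-ratio (pairs 𝔽 n) _ ⟩
      ratio (∑[ ij ∈ pairs 𝔽 n ] (q * q * ⟦ linked P (proj₁ ij) (proj₂ ij) ⟧)) 1
        ≡⟨ cong (λ c → ratio c 1) (∑-distribˡ-* (pairs 𝔽 n) (q * q) _) ⟩
      ratio (q * q * linkedPairs P) 1 ∎))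
      where open ℚₚ.≤-Reasoning

-- Coordinates frozen by pinning

⟦⟧+⟦⟧≤⟦⟧ : ∀ b c d → (b ≡ true → d ≡ true) → (c ≡ true → d ≡ true) → (b ≡ true → c ≡ false) →
  ⟦ b ⟧ + ⟦ c ⟧ ≤ ⟦ d ⟧
⟦⟧+⟦⟧≤⟦⟧ true  c d b⇒d _ b⇒¬c rewrite b⇒d refl | b⇒¬c refl = ℕₚ.≤-refl
⟦⟧+⟦⟧≤⟦⟧ false true  d _ c⇒d _ rewrite c⇒d refl = ℕₚ.≤-refl
⟦⟧+⟦⟧≤⟦⟧ false false d _ _   _ = z≤n

module FrozenGain (𝔽 : FiniteField) where

  open Field 𝔽
  open Coordinates 𝔽

  module _ {n : ℕ} where

    frozenCount : (Vector F n → Bool) → ℕ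
    frozenCount P = ∑[ j ∈ allFin n ] ⟦ frozen P j ⟧

    pin : (Vector F n → Bool) → Fin n → Vector F n → Bool
    pin P i x = P x ∧ (x i == 0#)

    frozenCount≤n : ∀ P → frozenCount P ≤ n
    frozenCount≤n P = begin
      frozenCount P          ≤⟨ ∑-mono-≤ (allFin n) (λ j → ⟦⟧≤1 (frozen P j)) ⟩
      ∑[ j ∈ allFin n ] 1    ≡⟨ ∑-const (allFin n) 1 ⟩
      length (allFin n) * 1  ≡⟨ ℕₚ.*-identityʳ _ ⟩
      length (allFin n)      ≡⟨ length-allFin n ⟩
      n                      ∎
      where open ℕₚ.≤-Reasoning

    frozenCount-cong : ∀ {P Q} → (∀ x → P x ≡ Q x) → frozenCount P ≡ frozenCount Q
    frozenCount-cong P≡Q = ∑-cong (allFin n) (λ j → cong (λ c → ⟦ ⌊ c ℕ.≟ 0 ⌋ ⟧)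
      (count-cong (λ x → cong (_∧ not (x j == 0#)) (P≡Q x))))

    _<ᵇ_ : Fin n → Fin n → Bool
    i <ᵇ j = ⌊ toℕ i ℕ.<? toℕ j ⌋

    linkedPairs-∑∑ : ∀ P → linkedPairs P ≡ ∑[ i ∈ allFin n ] ∑[ j ∈ allFin n ] ⟦ (i <ᵇ j) ∧ linked P i j ⟧
    linkedPairs-∑∑ P = trans (∑-concatMap (allFin n) _ _) (∑-cong (allFin n) (λ i → begin
      ∑ (map (i ,_) (filterᵇ (i <ᵇ_) (allFin n))) (λ ij → ⟦ linked P (proj₁ ij) (proj₂ ij) ⟧)
        ≡⟨ ∑-map (filterᵇ (i <ᵇ_) (allFin n)) (i ,_) _ ⟩
      ∑[ j ∈ filterᵇ (i <ᵇ_) (allFin n) ] ⟦ linked P i j ⟧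
        ≡⟨ ∑-filterᵇ (allFin n) (i <ᵇ_) _ ⟩
      ∑[ j ∈ allFin n ] (⟦ i <ᵇ j ⟧ * ⟦ linked P i j ⟧)
        ≡⟨ ∑-cong (allFin n) (λ j → ⟦∧⟧ (i <ᵇ j) _) ⟨
      ∑[ j ∈ allFin n ] ⟦ (i <ᵇ j) ∧ linked P i j ⟧ ∎))
      where open ≡-Reasoning

    frozen-or-linked⇒frozen-after-pin : ∀ P i j →
      ⟦ frozen P j ⟧ + ⟦ (i <ᵇ j) ∧ linked P i j ⟧ ≤ ⟦ frozen (pin P i) j ⟧
    frozen-or-linked⇒frozen-after-pin P i j = ⟦⟧+⟦⟧≤⟦⟧ _ _ _ stays-frozen becomes-frozen exclusive
      where
      freezes : count (λ x → pin P i x ∧ not (x j == 0#)) ≤ 0 → frozen (pin P i) j ≡ true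
      freezes h = ⇒⌊⌋≡true (_ ℕ.≟ 0) (ℕₚ.n≤0⇒n≡0 h)
      ∧-drop-middle : ∀ a e c → ⟦ (a ∧ e) ∧ c ⟧ ≤ ⟦ a ∧ c ⟧
      ∧-drop-middle true  true  c = ℕₚ.≤-refl
      ∧-drop-middle true  false c = z≤n
      ∧-drop-middle false e     c = z≤n
      stays-frozen : frozen P j ≡ true → frozen (pin P i) j ≡ true
      stays-frozen fj = freezes (ℕₚ.≤-trans
        (∑-mono-≤ (Vecs 𝔽 n) (λ x → ∧-drop-middle (P x) (x i == 0#) (not (x j == 0#))))
        (ℕₚ.≤-reflexive (⌊⌋≡true⇒ (_ ℕ.≟ 0) fj)))
      becomes-frozen : (i <ᵇ j) ∧ linked P i j ≡ true → frozen (pin P i) j ≡ true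
      becomes-frozen h = freezes (ℕₚ.≤-reflexive (trans
        (count-cong (λ x → Boolₚ.∧-assoc (P x) (x i == 0#) (not (x j == 0#))))
        (⌊⌋≡true⇒ (_ ℕ.≟ 0) (proj₂ (∧≡true⇒ {not (frozen P j)} (proj₂ (∧≡true⇒ {not (frozen P i)}
          (proj₂ (∧≡true⇒ {i <ᵇ j} h)))))))))
      exclusive : frozen P j ≡ true → (i <ᵇ j) ∧ linked P i j ≡ false
      exclusive fj rewrite fj = trans (cong (i <ᵇ j ∧_) (Boolₚ.∧-zeroʳ (not (frozen P i)))) (Boolₚ.∧-zeroʳ (i <ᵇ j))

    frozen-gain : ∀ P → n * frozenCount P + linkedPairs P ≤ ∑[ i ∈ allFin n ] frozenCount (pin P i)
    frozen-gain P = begin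
      n * frozenCount P + linkedPairs P
        ≡⟨ cong₂ _+_ (trans (cong (_* frozenCount P) (sym (length-allFin n))) (sym (∑-const (allFin n) _)))
                     (linkedPairs-∑∑ P) ⟩
      ∑[ i ∈ allFin n ] frozenCount P + ∑[ i ∈ allFin n ] ∑[ j ∈ allFin n ] ⟦ (i <ᵇ j) ∧ linked P i j ⟧
        ≡⟨ ∑-distrib-+ (allFin n) _ _ ⟨
      ∑[ i ∈ allFin n ] (frozenCount P + ∑[ j ∈ allFin n ] ⟦ (i <ᵇ j) ∧ linked P i j ⟧)
        ≡⟨ ∑-cong (allFin n) (λ i → ∑-distrib-+ (allFin n) _ _) ⟨
      ∑[ i ∈ allFin n ] ∑[ j ∈ allFin n ] (⟦ frozen P j ⟧ + ⟦ (i <ᵇ j) ∧ linked P i j ⟧)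
        ≤⟨ ∑-mono-≤ (allFin n) (λ i → ∑-mono-≤ (allFin n) (frozen-or-linked⇒frozen-after-pin P i)) ⟩
      ∑[ i ∈ allFin n ] frozenCount (pin P i) ∎
      where open ℕₚ.≤-Reasoning

-- Averaging over pin sequences

∑ℚ< : ℕ → (ℕ → ℚ) → ℚ
∑ℚ< T g = ∑ℚ[ s ∈ allFin T ] g (toℕ s)

syntax ∑ℚ< T (λ s → e) = ∑ℚ[ s < T ] e

∑ℚ<-suc : ∀ T (g : ℕ → ℚ) → ∑ℚ< (suc T) g ≡ g 0 ℚ.+ ∑ℚ< T (g ∘ suc)
∑ℚ<-suc T g = cong (g 0 ℚ.+_) (∑ℚ-tabulate T Fin.suc (g ∘ toℕ))

telescope : ∀ T (f β : ℕ → ℚ) → (∀ s → f s ℚ.+ β s ℚ.≤ f (suc s)) → ∑ℚ< T β ℚ.+ f 0 ℚ.≤ f T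
telescope zero    f β step = ℚₚ.≤-reflexive (ℚₚ.+-identityˡ (f 0))
telescope (suc T) f β step = begin
  ∑ℚ< (suc T) β ℚ.+ f 0           ≡⟨ cong (ℚ._+ f 0) (∑ℚ<-suc T β) ⟩
  β 0 ℚ.+ ∑ℚ< T (β ∘ suc) ℚ.+ f 0 ≡⟨ regroup (β 0) (∑ℚ< T (β ∘ suc)) (f 0) ⟩
  ∑ℚ< T (β ∘ suc) ℚ.+ (f 0 ℚ.+ β 0) ≤⟨ ℚₚ.+-monoʳ-≤ (∑ℚ< T (β ∘ suc)) (step 0) ⟩
  ∑ℚ< T (β ∘ suc) ℚ.+ f 1          ≤⟨ telescope T (f ∘ suc) (β ∘ suc) (step ∘ suc) ⟩
  f (suc T)                       ∎
  where
  open ℚₚ.≤-Reasoning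
  regroup : ∀ b Σ c → b ℚ.+ Σ ℚ.+ c ≡ Σ ℚ.+ (c ℚ.+ b)
  regroup b Σ c = trans (ℚₚ.+-assoc b Σ c) (trans (ℚₚ.+-comm b (Σ ℚ.+ c)) (ℚₚ.+-assoc Σ c b))

proper-fraction : ∀ ε → 0ℚ < ε → ε < 1ℚ →
  Σ ℕ λ p → Σ ℕ λ r′ → 1 ≤ p × p ≤ suc r′ × ε ≡ ratio p (suc r′)
proper-fraction ε@(mkℚ (ℤ.+ suc p′) r′ c) _ ε<1 = suc p′ , r′ , s≤s z≤n , p≤r , ε≡p/r
  where
  ε≡p/r : ε ≡ ratio (suc p′) (suc r′)
  ε≡p/r = sym (ℚₚ.normalize-coprime c)
  p≤r : suc p′ ≤ suc r′
  p≤r = subst₂ _≤_ (ℕₚ.*-identityʳ (suc p′)) (ℕₚ.*-identityˡ (suc r′))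
    (ratio-cancel-≤ (suc p′) (suc r′) 1 1 (subst (ℚ._≤ 1ℚ) ε≡p/r (ℚₚ.<⇒≤ ε<1)))
proper-fraction (mkℚ (ℤ.+ zero) r′ c) (ℚ.*<* (+<+ ()))
proper-fraction (mkℚ -[1+ n ] r′ c)   (ℚ.*<* ())

-- (r ∸ p) / r < D / (D + u) with D = 1 + r u, cleared of denominators.
horizon-margin : ∀ p r u → 1 ≤ p → p ≤ r → (r ∸ p) * (suc (r * u) + u) ℕ.< suc (r * u) * r
horizon-margin p r u 1≤p p≤r = begin-strict
  (r ∸ p) * (D + u)          ≡⟨ ℕₚ.*-distribˡ-+ (r ∸ p) D u ⟩
  (r ∸ p) * D + (r ∸ p) * u  <⟨ ℕₚ.+-monoʳ-< ((r ∸ p) * D) (ℕₚ.<-≤-trans (s≤s (ℕₚ.*-monoˡ-≤ u (ℕₚ.m∸n≤m r p)))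
                                                              (ℕₚ.m≤n*m D p {{ℕ.>-nonZero 1≤p}})) ⟩
  (r ∸ p) * D + p * D         ≡⟨ ℕₚ.*-distribʳ-+ D (r ∸ p) p ⟨
  (r ∸ p + p) * D             ≡⟨ cong (_* D) (ℕₚ.m∸n+n≡m p≤r) ⟩
  r * D                       ≡⟨ ℕₚ.*-comm r D ⟩
  D * r                       ∎
  where
  open ℕₚ.≤-Reasoning
  D = suc (r * u)

-- u = slack q r bounds the expected number of asymmetric steps, and the horizon
-- T = 1 + r u + u makes u / T < 1 / r ≤ ε.
slack : ℕ → ℕ → ℕ
slack q r = r * (q * q)

horizon : ℕ → ℕ → ℕ
horizon q r = suc (r * slack q r) + slack q r

module Averaging (𝔽 : FiniteField) {m n′ : ℕ} (A : Matrix 𝔽 m (suc n′))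
                 (ε : ℚ) (p r : ℕ) .{{_ : NonZero r}} (ε≡p/r : ε ≡ ratio p r) where

  open Field 𝔽
  open Kernel 𝔽
  open Coordinates 𝔽
  open PairTV 𝔽
  open FrozenGain 𝔽

  private
    n = suc n′
    u = slack q r
    n^≢0 : ∀ s → NonZero (n ^ s)
    n^≢0 s = ℕₚ.m^n≢0 n s

  pins : (s : ℕ) → List (Fin s → Fin n)
  pins s = allFuns s (allFin n)

  pinnedKernel : ∀ {s} → (Fin s → Fin n) → Vector F n → Bool
  pinnedKernel v = inKer 𝔽 (append 𝔽 A v)

  symmetricAfter : ∀ {s} → (Fin s → Fin n) → Bool
  symmetricAfter v = symmetric2? 𝔽 ε (μ 𝔽 (append 𝔽 A v))

  #symmetric #asymmetric Φ Λ : ℕ → ℕ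
  #symmetric  s = length (filterᵇ symmetricAfter (pins s))
  #asymmetric s = ∑[ v ∈ pins s ] ⟦ not (symmetricAfter v) ⟧
  Φ s = ∑[ v ∈ pins s ] frozenCount (pinnedKernel v)
  Λ s = ∑[ v ∈ pins s ] linkedPairs (pinnedKernel v)

  ∑-pins-suc : ∀ s (g : (Fin (suc s) → Fin n) → ℕ) →
    ∑ (pins (suc s)) g ≡ ∑[ i ∈ allFin n ] ∑[ v ∈ pins s ] g (i VF.∷ v)
  ∑-pins-suc s g = trans (∑-concatMap (allFin n) (λ i → map (i VF.∷_) (pins s)) g) (∑-cong (allFin n) (λ i → ∑-map (pins s) _ g))

  ∑-pins-1 : ∀ s → ∑[ v ∈ pins s ] 1 ≡ n ^ s
  ∑-pins-1 zero    = refl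
  ∑-pins-1 (suc s) = begin
    ∑[ v ∈ pins (suc s) ] 1                ≡⟨ ∑-pins-suc s (λ _ → 1) ⟩
    ∑[ i ∈ allFin n ] ∑[ v ∈ pins s ] 1    ≡⟨ ∑-cong (allFin n) (λ _ → ∑-pins-1 s) ⟩
    ∑[ i ∈ allFin n ] (n ^ s)              ≡⟨ ∑-const (allFin n) (n ^ s) ⟩
    length (allFin n) * n ^ s              ≡⟨ cong (_* n ^ s) (length-allFin n) ⟩
    n ^ suc s                              ∎
    where open ≡-Reasoning

  #symmetric+#asymmetric : ∀ s → #symmetric s + #asymmetric s ≡ n ^ s
  #symmetric+#asymmetric s = begin
    #symmetric s + #asymmetric s
      ≡⟨ cong (_+ #asymmetric s) (length-filterᵇ (pins s) symmetricAfter) ⟩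
    ∑[ v ∈ pins s ] ⟦ symmetricAfter v ⟧ + #asymmetric s
      ≡⟨ ∑-distrib-+ (pins s) _ _ ⟨
    ∑[ v ∈ pins s ] (⟦ symmetricAfter v ⟧ + ⟦ not (symmetricAfter v) ⟧)
      ≡⟨ ∑-cong (pins s) (λ v → ⟦b⟧+⟦not-b⟧ (symmetricAfter v)) ⟩
    ∑[ v ∈ pins s ] 1
      ≡⟨ ∑-pins-1 s ⟩
    n ^ s ∎
    where
    open ≡-Reasoning
    ⟦b⟧+⟦not-b⟧ : ∀ b → ⟦ b ⟧ + ⟦ not b ⟧ ≡ 1
    ⟦b⟧+⟦not-b⟧ true  = refl
    ⟦b⟧+⟦not-b⟧ false = refl

  Φ-gain : ∀ s → n * Φ s + Λ s ≤ Φ (suc s)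
  Φ-gain s = begin
    n * Φ s + Λ s
      ≡⟨ cong (_+ Λ s) (∑-distribˡ-* (pins s) n _) ⟨
    ∑[ v ∈ pins s ] (n * frozenCount (pinnedKernel v)) + Λ s
      ≡⟨ ∑-distrib-+ (pins s) _ _ ⟨
    ∑[ v ∈ pins s ] (n * frozenCount (pinnedKernel v) + linkedPairs (pinnedKernel v))
      ≤⟨ ∑-mono-≤ (pins s) (λ v → frozen-gain (pinnedKernel v)) ⟩
    ∑[ v ∈ pins s ] ∑[ i ∈ allFin n ] frozenCount (pin (pinnedKernel v) i)
      ≡⟨ ∑-cong (pins s) (λ v → ∑-cong (allFin n) (λ i →
           frozenCount-cong (λ x → sym (inKer-append-∷ A i v x)))) ⟩
    ∑[ v ∈ pins s ] ∑[ i ∈ allFin n ] frozenCount (pinnedKernel (i VF.∷ v))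
      ≡⟨ ∑-comm (pins s) (allFin n) _ ⟩
    ∑[ i ∈ allFin n ] ∑[ v ∈ pins s ] frozenCount (pinnedKernel (i VF.∷ v))
      ≡⟨ ∑-pins-suc s _ ⟨
    Φ (suc s) ∎
    where open ℕₚ.≤-Reasoning

  Φ≤ : ∀ s → Φ s ≤ n ^ suc s
  Φ≤ s = begin
    Φ s                         ≤⟨ ∑-mono-≤ (pins s) (λ v → frozenCount≤n (pinnedKernel v)) ⟩
    ∑[ v ∈ pins s ] n           ≡⟨ ∑-cong (pins s) (λ _ → ℕₚ.*-identityʳ n) ⟨
    ∑[ v ∈ pins s ] (n * 1)     ≡⟨ ∑-distribˡ-* (pins s) n (λ _ → 1) ⟩
    n * ∑[ v ∈ pins s ] 1       ≡⟨ cong (n *_) (∑-pins-1 s) ⟩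
    n ^ suc s                   ∎
    where open ℕₚ.≤-Reasoning

  #asymmetric-bound : ∀ s → #asymmetric s * (p * (n * n)) ≤ r * (q * q * Λ s)
  #asymmetric-bound s = begin
    #asymmetric s * (p * (n * n))
      ≡⟨ ∑-distribʳ-* (pins s) _ _ ⟨
    ∑[ v ∈ pins s ] (⟦ not (symmetricAfter v) ⟧ * (p * (n * n)))
      ≤⟨ ∑-mono-≤ (pins s) asymmetric-pin ⟩
    ∑[ v ∈ pins s ] (r * (q * q * linkedPairs (pinnedKernel v)))
      ≡⟨ ∑-distribˡ-* (pins s) r _ ⟩
    r * ∑[ v ∈ pins s ] (q * q * linkedPairs (pinnedKernel v))
      ≡⟨ cong (r *_) (∑-distribˡ-* (pins s) (q * q) _) ⟩
    r * (q * q * Λ s) ∎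
    where
    open ℕₚ.≤-Reasoning
    asymmetric-pin : ∀ v → ⟦ not (symmetricAfter v) ⟧ * (p * (n * n)) ≤ r * (q * q * linkedPairs (pinnedKernel v))
    asymmetric-pin v with symmetricAfter v in sym?
    ... | true  = z≤n
    ... | false = ℕₚ.≤-trans (ℕₚ.≤-reflexive (ℕₚ.+-identityʳ _)) (¬symmetric⇒ (append 𝔽 A v) ε p r ε≡p/r sym?)

  -- Averages over a uniform pin sequence of length s; Φ and Λ get extra factors 1 / n and
  -- 1 / n² so that frozenFrac s ≤ 1 and frozenFrac telescopes.
  symFrac asymFrac frozenFrac linkedFrac : ℕ → ℚ
  symFrac    s = ratio (#symmetric s) (n ^ s)
  asymFrac   s = ratio (#asymmetric s) (n ^ s)
  frozenFrac s = ratio (Φ s) (n ^ suc s)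
  linkedFrac s = ratio (Λ s) (n ^ suc (suc s))

  symFrac+asymFrac : ∀ s → symFrac s ℚ.+ asymFrac s ≡ 1ℚ
  symFrac+asymFrac s = trans (ratio-+-sameDenom (#symmetric s) (n ^ s) (#asymmetric s))
    (trans (cong (λ c → ratio c (n ^ s)) (#symmetric+#asymmetric s)) (ratio-self (n ^ s)))
    where instance n^s≢0 = n^≢0 s

  frozenFrac-step : ∀ s → frozenFrac s ℚ.+ linkedFrac s ℚ.≤ frozenFrac (suc s)
  frozenFrac-step s = begin
    ratio (Φ s) (n ^ suc s) ℚ.+ linkedFrac s              ≡⟨ cong (ℚ._+ linkedFrac s) (ratio-scale n (Φ s) (n ^ suc s)) ⟩
    ratio (n * Φ s) (n ^ suc (suc s)) ℚ.+ linkedFrac s    ≡⟨ ratio-+-sameDenom (n * Φ s) (n ^ suc (suc s)) (Λ s) ⟩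
    ratio (n * Φ s + Λ s) (n ^ suc (suc s))               ≤⟨ ratio-mono-≤-numerator _ _ (n ^ suc (suc s)) (Φ-gain s) ⟩
    frozenFrac (suc s)                                    ∎
    where
    open ℚₚ.≤-Reasoning
    instance
      n^s+1≢0 = n^≢0 (suc s)
      n^s+2≢0 = n^≢0 (suc (suc s))

  ∑linkedFrac≤1 : ∀ T → ∑ℚ< T linkedFrac ℚ.≤ 1ℚ
  ∑linkedFrac≤1 T = begin
    ∑ℚ< T linkedFrac                     ≡⟨ ℚₚ.+-identityʳ _ ⟨
    ∑ℚ< T linkedFrac ℚ.+ 0ℚ              ≤⟨ ℚₚ.+-monoʳ-≤ (∑ℚ< T linkedFrac) (ratio-nonNeg (Φ 0) (n ^ 1)) ⟩
    ∑ℚ< T linkedFrac ℚ.+ frozenFrac 0    ≤⟨ telescope T frozenFrac linkedFrac frozenFrac-step ⟩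
    frozenFrac T                         ≤⟨ ratio≤1 (Φ T) (n ^ suc T) (Φ≤ T) ⟩
    1ℚ                                   ∎
    where
    open ℚₚ.≤-Reasoning
    instance n^T+1≢0 = n^≢0 (suc T)

  asymmetric-cross : ∀ s → p * #asymmetric s * (1 * n ^ suc (suc s)) ≤ u * Λ s * (1 * n ^ s)
  asymmetric-cross s = begin
    p * X * (1 * (n * (n * N)))   ≡⟨ rearrangeˡ p X n N ⟩
    X * (p * (n * n)) * N         ≤⟨ ℕₚ.*-monoˡ-≤ N (#asymmetric-bound s) ⟩
    r * (q * q * Λ s) * N         ≡⟨ rearrangeʳ r (q * q) (Λ s) N ⟩
    r * (q * q) * Λ s * (1 * N)   ∎
    where
    open ℕₚ.≤-Reasoning
    X = #asymmetric s
    N = n ^ s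
    rearrangeˡ : ∀ p X n N → p * X * (1 * (n * (n * N))) ≡ X * (p * (n * n)) * N
    rearrangeˡ = solve-∀
    rearrangeʳ : ∀ r Q L N → r * (Q * L) * N ≡ r * Q * L * (1 * N)
    rearrangeʳ = solve-∀

  p·asymFrac≤u·linkedFrac : ∀ s → ratio p 1 ℚ.* asymFrac s ℚ.≤ ratio u 1 ℚ.* linkedFrac s
  p·asymFrac≤u·linkedFrac s = begin
    ratio p 1 ℚ.* asymFrac s                   ≡⟨ ratio-* p 1 (#asymmetric s) (n ^ s) ⟩
    ratio (p * #asymmetric s) (1 * n ^ s)      ≤⟨ ratio-mono-≤ _ _ _ _ {{ℕₚ.m*n≢0 1 (n ^ s)}}
                                                    {{ℕₚ.m*n≢0 1 (n ^ suc (suc s))}} (asymmetric-cross s) ⟩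
    ratio (u * Λ s) (1 * n ^ suc (suc s))      ≡⟨ ratio-* u 1 (Λ s) (n ^ suc (suc s)) ⟨
    ratio u 1 ℚ.* linkedFrac s                 ∎
    where
    open ℚₚ.≤-Reasoning
    instance
      n^s≢0   = n^≢0 s
      n^s+2≢0 = n^≢0 (suc (suc s))

  ∑asymFrac≤u : ∀ T → 1 ≤ p → ∑ℚ< T asymFrac ℚ.≤ ratio u 1
  ∑asymFrac≤u T 1≤p = begin
    ∑ℚ< T asymFrac                            ≡⟨ ℚₚ.*-identityˡ _ ⟨
    1ℚ ℚ.* ∑ℚ< T asymFrac                     ≤⟨ ℚₚ.*-monoʳ-≤-nonNeg (∑ℚ< T asymFrac) {{ℚ.nonNegative ∑asym≥0}}
                                                    (ratio-mono-≤-numerator 1 p 1 1≤p) ⟩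
    ratio p 1 ℚ.* ∑ℚ< T asymFrac              ≡⟨ ∑ℚ-distribˡ-* (allFin T) (ratio p 1) _ ⟨
    ∑ℚ[ s < T ] (ratio p 1 ℚ.* asymFrac s)    ≤⟨ ∑ℚ-mono-≤ (allFin T) (p·asymFrac≤u·linkedFrac ∘ toℕ) ⟩
    ∑ℚ[ s < T ] (ratio u 1 ℚ.* linkedFrac s)  ≡⟨ ∑ℚ-distribˡ-* (allFin T) (ratio u 1) _ ⟩
    ratio u 1 ℚ.* ∑ℚ< T linkedFrac            ≤⟨ ℚₚ.*-monoˡ-≤-nonNeg (ratio u 1) {{ℚ.nonNegative (ratio-nonNeg u 1)}} (∑linkedFrac≤1 T) ⟩
    ratio u 1 ℚ.* 1ℚ                          ≡⟨ ℚₚ.*-identityʳ _ ⟩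
    ratio u 1                                 ∎
    where
    open ℚₚ.≤-Reasoning
    ∑asym≥0 : 0ℚ ℚ.≤ ∑ℚ< T asymFrac
    ∑asym≥0 = ∑ℚ-nonNeg (allFin T) _ (λ s → ratio-nonNeg (#asymmetric (toℕ s)) (n ^ toℕ s))

  ∑symFrac+∑asymFrac : ∀ T → ∑ℚ< T symFrac ℚ.+ ∑ℚ< T asymFrac ≡ ratio T 1
  ∑symFrac+∑asymFrac T = begin
    ∑ℚ< T symFrac ℚ.+ ∑ℚ< T asymFrac         ≡⟨ ∑ℚ-distrib-+ (allFin T) _ _ ⟨
    ∑ℚ[ s < T ] (symFrac s ℚ.+ asymFrac s)   ≡⟨ ∑ℚ-cong (allFin T) (symFrac+asymFrac ∘ toℕ) ⟩
    ∑ℚ[ s ∈ allFin T ] ratio 1 1             ≡⟨ ∑ℚ-ratio (allFin T) (λ _ → 1) ⟩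
    ratio (∑[ s ∈ allFin T ] 1) 1            ≡⟨ cong (λ c → ratio c 1) (trans (∑-const (allFin T) 1)
                                                   (trans (ℕₚ.*-identityʳ _) (length-allFin T))) ⟩
    ratio T 1                                ∎
    where open ≡-Reasoning

  probSym≡ : ∀ T → probSym 𝔽 T ε A ≡ ratio 1 T ℚ.* ∑ℚ< T symFrac
  probSym≡ T = ∑ℚ-distribˡ-* (allFin T) (ratio 1 T) _

  probSym-bound : ∀ T D .{{_ : NonZero T}} → D + u ≡ T → (r ∸ p) * T ℕ.< D * r → 1 ≤ p → p ≤ r →
    1ℚ - ε < probSym 𝔽 T ε A
  probSym-bound T D {{T≢0}} D+u≡T margin 1≤p p≤r = begin-strict
    1ℚ - ε                          ≡⟨ trans (cong (1ℚ -_) ε≡p/r) (1-ratio p r p≤r) ⟩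
    ratio (r ∸ p) r                 <⟨ ratio-mono-< (r ∸ p) r D T margin ⟩
    ratio D T                       ≡⟨ ratio-cong D T (1 * D) (T * 1) {{T≢0}} {{ℕₚ.m*n≢0 T 1}}
                                         (trans (cong (D *_) (ℕₚ.*-identityʳ T)) (cong (_* T) (sym (ℕₚ.*-identityˡ D)))) ⟩
    ratio (1 * D) (T * 1)           ≡⟨ ratio-* 1 T D 1 ⟨
    ratio 1 T ℚ.* ratio D 1         ≤⟨ ℚₚ.*-monoˡ-≤-nonNeg (ratio 1 T) {{ℚ.nonNegative (ratio-nonNeg 1 T)}} D≤∑sym ⟩
    ratio 1 T ℚ.* ∑ℚ< T symFrac     ≡⟨ probSym≡ T ⟨
    probSym 𝔽 T ε A                 ∎
    where
    open ℚₚ.≤-Reasoning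
    D≤∑sym : ratio D 1 ℚ.≤ ∑ℚ< T symFrac
    D≤∑sym = begin
      ratio D 1                                          ≡⟨ p+q-q≡p (ratio D 1) (ratio u 1) ⟨
      ratio D 1 ℚ.+ ratio u 1 ℚ.- ratio u 1              ≡⟨ cong (ℚ._- ratio u 1) (trans (ratio-+-sameDenom D 1 u)
                                                              (trans (cong (λ c → ratio c 1) D+u≡T) (sym (∑symFrac+∑asymFrac T)))) ⟩
      ∑ℚ< T symFrac ℚ.+ ∑ℚ< T asymFrac ℚ.- ratio u 1    ≤⟨ ℚₚ.+-monoˡ-≤ (ℚ.- ratio u 1) (ℚₚ.+-monoʳ-≤ (∑ℚ< T symFrac) (∑asymFrac≤u T 1≤p)) ⟩
      ∑ℚ< T symFrac ℚ.+ ratio u 1 ℚ.- ratio u 1          ≡⟨ p+q-q≡p (∑ℚ< T symFrac) (ratio u 1) ⟩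
      ∑ℚ< T symFrac                                      ∎

lemma3p1 : (𝔽 : FiniteField) → (ε : ℚ) → 0ℚ < ε → ε < 1ℚ →
    Σ ℕ (λ T → 1 ≤ T × ((m n : ℕ) → 1 ≤ n → (A : Matrix 𝔽 m n) →
      1ℚ - ε < probSym 𝔽 T ε A))
lemma3p1 𝔽 ε 0<ε ε<1 = witness (proper-fraction ε 0<ε ε<1)
  where
  open FiniteField 𝔽 using (q)
  witness : (Σ ℕ λ p → Σ ℕ λ r′ → 1 ≤ p × p ≤ suc r′ × ε ≡ ratio p (suc r′)) →
    Σ ℕ (λ T → 1 ≤ T × ((m n : ℕ) → 1 ≤ n → (A : Matrix 𝔽 m n) → 1ℚ - ε < probSym 𝔽 T ε A))
  witness (p , r′ , 1≤p , p≤r , ε≡p/r) = horizon q r , s≤s z≤n , bound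
    where
    r = suc r′
    bound : (m n : ℕ) → 1 ≤ n → (A : Matrix 𝔽 m n) → 1ℚ - ε < probSym 𝔽 (horizon q r) ε A
    bound m (suc n′) _ A = Averaging.probSym-bound 𝔽 A ε p r ε≡p/r (horizon q r) (suc (r * slack q r)) refl
      (horizon-margin p r (slack q r) 1≤p p≤r) 1≤p p≤r
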